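{- Let $A_1=(1,0,-1)^8\in\mathbb{Z}^{24}$, $A_2=(0,1,-1,-1,3,-2,-2,5,-3,-3,7,-4,-4,9,-5,-5,11,-6,-6,13,-7,-7,15,-8)\in\mathbb{Z}^{24}$, and $$\mathcal{O}=\{a_1A_1+a_2A_2 \mid a_1\in\mathbb{Z},\ a_2=\pm 3^{\alpha}2^{\beta}\text{ with }\alpha\in\{0,1\},\ \beta\in\mathbb{N},\text{ and } 3\nmid\gcd(a_1,a_2)\}.$$ Then for every $A\in\mathcal{O}$ and every odd positive integer $m$, the orbit of $S=\mathrm{IAP}(\pi_m(A),\pi_m(A)X_{24})$ is periodic of period $(3m,3m)$, and the triangles $\nabla(S[3\lambda m])$ are balanced in $\mathbb{Z}/m\mathbb{Z}$ for all non-negative integers $\lambda$.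
   Context: $\pi_m$ is reduction modulo $m$. $X_{24}$ is the $24\times24$ integer matrix with entries $\delta_{r,s}+\delta_{r,25-s}$; tuples are row vectors. For $k$-tuples $A=(a_0,\dots,a_{k-1})$, $D=(d_0,\dots,d_{k-1})$, $\mathrm{IAP}(A,D)$ is the doubly infinite sequence $(u_j)_{j\in\mathbb{Z}}$ with $u_{qk+r}=a_r+qd_r$. The orbit of $(u_j)$ is $(a_{i,j})_{(i,j)\in\mathbb{N}\times\mathbb{Z}}$ with $a_{0,j}=u_j$, $a_{i,j}=-a_{i-1,j}-a_{i-1,j+1}$ for $i\ge1$; periodic of period $(p,q)$ means $a_{i+q,j}=a_{i,j+p}=a_{i,j}$ for all $(i,j)$. $S[n]=(u_0,\dots,u_{n-1})$. $\nabla(u_0,\dots,u_{n-1})$ is the multiset $(a_{i,j})_{i,j\ge0,\,i+j<n}$ with $a_{0,j}=u_j$, $a_{i,j}=-a_{i-1,j}-a_{i-1,j+1}$; balanced means all elements of $\mathbb{Z}/m\mathbb{Z}$ have equal multiplicity. -}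

module Defs where

open import Data.Nat as ℕ using (ℕ; zero; suc; NonZero)
import Data.Nat.Properties as ℕP
open import Data.Integer using (ℤ; +_; -_; _-_; _+_; _*_; _/ℕ_; _%ℕ_)
open import Data.Integer.DivMod using (n%ℕd<d)
open import Data.Fin as F using (Fin; fromℕ<; toℕ)
open import Data.Bool using (Bool; true; false)
open import Data.Product using (_×_)
open import Relation.Nullary using (yes; no)
open import Data.Vec using (Vec; []; _∷_; lookup; replicate; concat)
open import Data.List using (List; []; _∷_; _++_; length; filter; map; upTo)
open import Relation.Binary.PropositionalEquality using (_≡_)

-- Z/mZ is represented by the canonical representatives 0,…,m-1 (as ℕ);
-- π m is reduction modulo m (Euclidean remainder, always in [0,m)).
π : (m : ℕ) .{{_ : NonZero m}} → ℤ → ℕ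
π m x = x %ℕ m

Tuple : ℕ → Set → Set
Tuple k A = Fin k → A

πT : (m : ℕ) .{{_ : NonZero m}} {k : ℕ} → Tuple k ℤ → Tuple k ℕ
πT m A i = π m (A i)

sumFin : (n : ℕ) → (Fin n → ℤ) → ℤ
sumFin zero    f = + 0
sumFin (suc n) f = f F.zero + sumFin n (λ i → f (F.suc i))

-- Kronecker delta on indices 1..24 (Fin 24 index i stands for i+1)
δ : ℕ → ℕ → ℤ
δ r s with r ℕ.≟ s
... | yes _ = + 1
... | no  _ = + 0

X24 : Fin 24 → Fin 24 → ℤ
X24 r s = δ (suc (toℕ r)) (suc (toℕ s)) + δ (suc (toℕ r)) (25 ℕ.∸ suc (toℕ s))

rowMul : (m : ℕ) .{{_ : NonZero m}} {k : ℕ} → Tuple k ℕ → (Fin k → Fin k → ℤ) → Tuple k ℕ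
rowMul m {k} A X s = π m (sumFin k (λ r → + A r * X r s))

-- IAP(A, D) over Z/mZ:  u_{qk+r} = a_r + q d_r,  j ∈ ℤ
IAP : (m : ℕ) .{{_ : NonZero m}} (k : ℕ) .{{_ : NonZero k}} → Tuple k ℕ → Tuple k ℕ → ℤ → ℕ
IAP m k A D j = π m (+ A r + (j /ℕ k) * + D r)
  where r = fromℕ< (n%ℕd<d j k)

orbit : (m : ℕ) .{{_ : NonZero m}} → (ℤ → ℕ) → ℕ → ℤ → ℕ
orbit m u zero    j = u j
orbit m u (suc i) j = π m (- (+ orbit m u i j) - + orbit m u i (j + + 1))

PeriodicOrbit : (m : ℕ) .{{_ : NonZero m}} → (ℤ → ℕ) → ℕ → ℕ → Set
PeriodicOrbit m u p q = ∀ (i : ℕ) (j : ℤ) →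
  (orbit m u (i ℕ.+ q) j ≡ orbit m u i j) × (orbit m u i (j + + p) ≡ orbit m u i j)

prefix : (ℤ → ℕ) → ℕ → List ℕ
prefix u n = map (λ t → u (+ t)) (upTo n)

nextRow : (m : ℕ) .{{_ : NonZero m}} → List ℕ → List ℕ
nextRow m (x ∷ y ∷ rest) = π m (- (+ x) - + y) ∷ nextRow m (y ∷ rest)
nextRow m _ = []

triangleAux : (m : ℕ) .{{_ : NonZero m}} → ℕ → List ℕ → List ℕ
triangleAux m zero    l = []
triangleAux m (suc f) l = l ++ triangleAux m f (nextRow m l)

-- ∇(u_0,…,u_{n-1}) as a multiset (list): rows i = 0,…,n-1, row i has entries a_{i,j}, j < n-i
∇ : (m : ℕ) .{{_ : NonZero m}} → List ℕ → List ℕ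
∇ m l = triangleAux m (length l) l

mult : ℕ → List ℕ → ℕ
mult c l = length (filter (c ℕ.≟_) l)

Balanced : (m : ℕ) → List ℕ → Set
Balanced m l = ∀ (c d : Fin m) → mult (toℕ c) l ≡ mult (toℕ d) l

A₁ : Tuple 24 ℤ
A₁ = lookup (concat (replicate 8 (+ 1 ∷ + 0 ∷ - (+ 1) ∷ [])))

A₂ : Tuple 24 ℤ
A₂ = lookup (+ 0 ∷ + 1 ∷ - + 1 ∷ - + 1 ∷ + 3 ∷ - + 2 ∷ - + 2 ∷ + 5 ∷ - + 3 ∷ - + 3 ∷ + 7 ∷ - + 4 ∷
             - + 4 ∷ + 9 ∷ - + 5 ∷ - + 5 ∷ + 11 ∷ - + 6 ∷ - + 6 ∷ + 13 ∷ - + 7 ∷ - + 7 ∷ + 15 ∷ - + 8 ∷ [])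

lincomb : ℤ → ℤ → Tuple 24 ℤ
lincomb a₁ a₂ i = a₁ * A₁ i + a₂ * A₂ i

signed : Bool → ℤ → ℤ
signed true  x = x
signed false x = - x

-- Write the column of row i as j = i + r + 3k with 0 ≤ r < 3. The entry a_{i,j} of the orbit of S is then
-- a₁ε(r) + a₂γ(i,k,r) mod m, where ε = (1, 0, −1) and γ is affine in i and k; the shifts k ↦ k + m and
-- (i, k) ↦ (i + 3m, k − m) change γ by multiples of m, which gives the period (3m, 3m).
-- In the triangle of size N = 3λm the rotation (i, t) ↦ (N − 1 − i − t, i) permutes the residue classes r
-- cyclically and fixes γ mod m, so every class contributes like the class r = 0, on which the entry only
-- depends on t − i mod 3m. As 3m is odd, all residues of t − i mod 3m occur equally often in the triangle,
-- so every value x occurs D · #{(ρ, g) ∈ {0,1,2} × ℤ/m : a₁ε(ρ) − a₂g ≡ x} times. That count is 3: if a₂ is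
-- a unit mod m each ρ has exactly one g; otherwise 3 ∣ m, a₂ = ±3·2^β and 3 ∤ a₁, and exactly one ρ has
-- a₁ε(ρ) ≡ x (mod 3), with three solutions g.

{-# OPTIONS --safe #-}
module Submission where

open import Data.Nat as ℕ using (ℕ; NonZero)
open import Data.Integer using (ℤ)
open import Data.Fin as Fin using (Fin; toℕ)
open import Relation.Binary.PropositionalEquality using (_≡_)

module IntegerCasts where

  open import Data.Nat using (_≤_; _∸_)
  open import Data.Integer using (+_; _-_)
  open import Data.Integer.Properties using (⊖-≥; m-n≡m⊖n)
  open import Relation.Binary.PropositionalEquality using (_≡_; trans; sym)

  pos-∸ : ∀ {m n} → n ≤ m → + (m ∸ n) ≡ + m - + n
  pos-∸ {m} {n} n≤m = trans (sym (⊖-≥ n≤m)) (sym (m-n≡m⊖n m n))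

module Modular where

  open import Data.Nat as ℕ using (ℕ; suc; NonZero)
  import Data.Nat.DivMod as ℕD
  open import Data.Integer using (ℤ; +_; -[1+_]; -_; _+_; _-_; _*_; _/ℕ_)
  import Data.Integer.Properties as ℤP
  open import Data.Integer.DivMod using (n%ℕd<d; a≡a%ℕn+[a/ℕn]*n)
  open import Data.Integer.Divisibility.Signed
    using (_∣_; divides; ∣-trans; ∣m∣n⇒∣m+n; ∣m⇒∣-m; ∣n⇒∣m*n; ∣m⇒∣m*n; module ∣-Reasoning)
  open import Data.Integer.Tactic.RingSolver using (solve-∀; solve)
  open import Data.List using ([]; _∷_)
  open import Function using (_$_)
  open import Relation.Binary.Bundles using (Setoid)
  open import Relation.Binary.PropositionalEquality
  import Relation.Binary.Reasoning.Setoid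
  open import Defs using (π)

  infix 4 _≡_[mod_]

  record _≡_[mod_] (x y k : ℤ) : Set where
    constructor ≡-mod
    field ∣-difference : k ∣ x - y

  record IsUnit (k a : ℤ) : Set where
    constructor unit
    field
      inverse    : ℤ
      invertible : a * inverse ≡ + 1 [mod k ]

  module Congruence (k : ℤ) where

    ≡⇒≡-mod : ∀ {x y} → x ≡ y → x ≡ y [mod k ]
    ≡⇒≡-mod {x} refl = ≡-mod (divides (+ 0) (solve (x ∷ k ∷ [])))

    ≡-mod-refl : ∀ {x} → x ≡ x [mod k ]
    ≡-mod-refl = ≡⇒≡-mod refl

    ≡-mod-sym : ∀ {x y} → x ≡ y [mod k ] → y ≡ x [mod k ]
    ≡-mod-sym {x} {y} (≡-mod k∣x-y) = ≡-mod $ begin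
      k         ∣⟨ ∣m⇒∣-m k∣x-y ⟩
      - (x - y) ≡⟨ solve (x ∷ y ∷ []) ⟩
      y - x     ∎
      where open ∣-Reasoning

    ≡-mod-trans : ∀ {x y z} → x ≡ y [mod k ] → y ≡ z [mod k ] → x ≡ z [mod k ]
    ≡-mod-trans {x} {y} {z} (≡-mod k∣x-y) (≡-mod k∣y-z) = ≡-mod $ begin
      k                 ∣⟨ ∣m∣n⇒∣m+n k∣x-y k∣y-z ⟩
      (x - y) + (y - z) ≡⟨ solve (x ∷ y ∷ z ∷ []) ⟩
      x - z             ∎
      where open ∣-Reasoning

    ≡-mod-setoid : Setoid _ _
    ≡-mod-setoid = record
      { Carrier = ℤ
      ; _≈_ = _≡_[mod k ]
      ; isEquivalence = record { refl = ≡-mod-refl ; sym = ≡-mod-sym ; trans = ≡-mod-trans }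
      }

    module ≡-mod-Reasoning = Relation.Binary.Reasoning.Setoid ≡-mod-setoid

    +-cong : ∀ {x y x′ y′} → x ≡ y [mod k ] → x′ ≡ y′ [mod k ] → x + x′ ≡ y + y′ [mod k ]
    +-cong {x} {y} {x′} {y′} (≡-mod k∣x-y) (≡-mod k∣x′-y′) = ≡-mod $ begin
      k                     ∣⟨ ∣m∣n⇒∣m+n k∣x-y k∣x′-y′ ⟩
      (x - y) + (x′ - y′)   ≡⟨ solve (x ∷ y ∷ x′ ∷ y′ ∷ []) ⟩
      (x + x′) - (y + y′)   ∎
      where open ∣-Reasoning

    neg-cong : ∀ {x y} → x ≡ y [mod k ] → - x ≡ - y [mod k ]
    neg-cong {x} {y} (≡-mod k∣x-y) = ≡-mod $ begin
      k         ∣⟨ ∣m⇒∣-m k∣x-y ⟩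
      - (x - y) ≡⟨ solve (x ∷ y ∷ []) ⟩
      - x - - y ∎
      where open ∣-Reasoning

    *-cong : ∀ {x y x′ y′} → x ≡ y [mod k ] → x′ ≡ y′ [mod k ] → x * x′ ≡ y * y′ [mod k ]
    *-cong {x} {y} {x′} {y′} (≡-mod k∣x-y) (≡-mod k∣x′-y′) = ≡-mod $ begin
      k                             ∣⟨ ∣m∣n⇒∣m+n (∣n⇒∣m*n x k∣x′-y′) (∣m⇒∣m*n y′ k∣x-y) ⟩
      x * (x′ - y′) + (x - y) * y′  ≡⟨ solve (x ∷ y ∷ x′ ∷ y′ ∷ []) ⟩
      x * x′ - y * y′               ∎
      where open ∣-Reasoning

    +-congˡ : ∀ z {x y} → x ≡ y [mod k ] → z + x ≡ z + y [mod k ]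
    +-congˡ z = +-cong (≡-mod-refl {z})

    +-congʳ : ∀ z {x y} → x ≡ y [mod k ] → x + z ≡ y + z [mod k ]
    +-congʳ z x≡y = +-cong x≡y (≡-mod-refl {z})

    *-congˡ : ∀ z {x y} → x ≡ y [mod k ] → z * x ≡ z * y [mod k ]
    *-congˡ z = *-cong (≡-mod-refl {z})

    *-congʳ : ∀ z {x y} → x ≡ y [mod k ] → x * z ≡ y * z [mod k ]
    *-congʳ z x≡y = *-cong x≡y (≡-mod-refl {z})

    unit-cancelˡ : ∀ {a b x y} → a * b ≡ + 1 [mod k ] → b * x ≡ b * y [mod k ] → x ≡ y [mod k ]
    unit-cancelˡ {a} {b} {x} {y} ab≡1 bx≡by = begin
      x               ≡⟨ ℤP.*-identityˡ x ⟨
      + 1 * x         ≈⟨ *-congʳ x ab≡1 ⟨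
      a * b * x       ≡⟨ ℤP.*-assoc a b x ⟩
      a * (b * x)     ≈⟨ *-congˡ a bx≡by ⟩
      a * (b * y)     ≡⟨ ℤP.*-assoc a b y ⟨
      a * b * y       ≈⟨ *-congʳ y ab≡1 ⟩
      + 1 * y         ≡⟨ ℤP.*-identityˡ y ⟩
      y               ∎
      where open ≡-mod-Reasoning

    ≡-mod⇒x-y≡0 : ∀ {x y} → x ≡ y [mod k ] → x - y ≡ + 0 [mod k ]
    ≡-mod⇒x-y≡0 {x} {y} (≡-mod k∣x-y) = ≡-mod (subst (k ∣_) (sym (ℤP.+-identityʳ (x - y))) k∣x-y)

    x-y≡0⇒≡-mod : ∀ {x y} → x - y ≡ + 0 [mod k ] → x ≡ y [mod k ]
    x-y≡0⇒≡-mod {x} {y} (≡-mod k∣x-y-0) = ≡-mod (subst (k ∣_) (ℤP.+-identityʳ (x - y)) k∣x-y-0)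

    +-multiple : ∀ x q → x + q * k ≡ x [mod k ]
    +-multiple x q = ≡-mod (divides q (solve (x ∷ q ∷ k ∷ [])))


  ≡-mod-∣ : ∀ {d k x y} → d ∣ k → x ≡ y [mod k ] → x ≡ y [mod d ]
  ≡-mod-∣ d∣k (≡-mod k∣x-y) = ≡-mod (∣-trans d∣k k∣x-y)

  module Reduction (n : ℕ) .{{_ : NonZero n}} where

    open Congruence (+ n)

    π< : ∀ x → π n x ℕ.< n
    π< x = n%ℕd<d x n

    π-≡-mod : ∀ x → + π n x ≡ x [mod + n ]
    π-≡-mod x = ≡-mod-sym (≡-mod (divides (x /ℕ n) (subtract (a≡a%ℕn+[a/ℕn]*n x n))))
      where
        subtract : ∀ {x r d} → x ≡ r + d → x - r ≡ d
        subtract {r = r} {d} refl = solve (r ∷ d ∷ [])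

    private
      x≡y+[x-y] : ∀ x y → x ≡ y + (x - y)
      x≡y+[x-y] = solve-∀

      y≡x-[x-y] : ∀ x y → y ≡ x - (x - y)
      y≡x-[x-y] = solve-∀

      remainder-unique : ∀ {a b} q → a ℕ.< n → b ℕ.< n → + a ≡ + b + + q * + n → a ≡ b
      remainder-unique {a} {b} q a<n b<n eq = begin
        a                  ≡⟨ ℕD.m<n⇒m%n≡m a<n ⟨
        a ℕ.% n            ≡⟨ cong (ℕ._% n) (ℤP.+-injective a≡b+qn) ⟩
        (b ℕ.+ q ℕ.* n) ℕ.% n ≡⟨ ℕD.[m+kn]%n≡m%n b q n ⟩
        b ℕ.% n            ≡⟨ ℕD.m<n⇒m%n≡m b<n ⟩
        b                  ∎
        where
          open ≡-Reasoning
          a≡b+qn : + a ≡ + (b ℕ.+ q ℕ.* n)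
          a≡b+qn = trans eq (trans (cong (_+_ (+ b)) (sym (ℤP.pos-* q n))) (sym (ℤP.pos-+ b (q ℕ.* n))))

    ≡-mod⇒≡ : ∀ {a b} → a ℕ.< n → b ℕ.< n → + a ≡ + b [mod + n ] → a ≡ b
    ≡-mod⇒≡ {a} {b} a<n b<n (≡-mod (divides (+ q) eq)) =
      remainder-unique q a<n b<n (trans (x≡y+[x-y] (+ a) (+ b)) (cong (_+_ (+ b)) eq))
    ≡-mod⇒≡ {a} {b} a<n b<n (≡-mod (divides -[1+ q ] eq)) =
      sym (remainder-unique (suc q) b<n a<n (begin
        + b                       ≡⟨ y≡x-[x-y] (+ a) (+ b) ⟩
        + a - (+ a - + b)         ≡⟨ cong (λ d → + a - d) eq ⟩
        + a - -[1+ q ] * + n      ≡⟨ cong (_+_ (+ a)) (ℤP.neg-distribˡ-* -[1+ q ] (+ n)) ⟩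
        + a + + suc q * + n       ∎))
      where open ≡-Reasoning

    π-cong : ∀ {x y} → x ≡ y [mod + n ] → π n x ≡ π n y
    π-cong {x} {y} x≡y = ≡-mod⇒≡ (π< x) (π< y) (begin
      + π n x ≈⟨ π-≡-mod x ⟩
      x       ≈⟨ x≡y ⟩
      y       ≈⟨ π-≡-mod y ⟨
      + π n y ∎)
      where open ≡-mod-Reasoning

    π-injective : ∀ {x y} → π n x ≡ π n y → x ≡ y [mod + n ]
    π-injective {x} {y} πx≡πy = begin
      x       ≈⟨ π-≡-mod x ⟨
      + π n x ≡⟨ cong +_ πx≡πy ⟩
      + π n y ≈⟨ π-≡-mod y ⟩
      y       ∎
      where open ≡-mod-Reasoning

    π-small : ∀ {r} → r ℕ.< n → π n (+ r) ≡ r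
    π-small {r} r<n = ≡-mod⇒≡ (π< (+ r)) r<n (π-≡-mod (+ r))

    ≡π⇒≡-mod : ∀ {r} x → r ≡ π n x → + r ≡ x [mod + n ]
    ≡π⇒≡-mod {r} x r≡πx = ≡-mod-trans (≡⇒≡-mod (cong +_ r≡πx)) (π-≡-mod x)

    π-+-multiple : ∀ x q → π n (x + q * + n) ≡ π n x
    π-+-multiple x q = π-cong (+-multiple x q)

    π≡0⇒≡-mod-0 : ∀ {x} → π n x ≡ 0 → x ≡ + 0 [mod + n ]
    π≡0⇒≡-mod-0 {x} πx≡0 = π-injective {x} {+ 0} (trans πx≡0 (sym (π-small (ℕ.>-nonZero⁻¹ n))))

    ≡-mod-0⇒π≡0 : ∀ {x} → x ≡ + 0 [mod + n ] → π n x ≡ 0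
    ≡-mod-0⇒π≡0 x≡0 = trans (π-cong x≡0) (π-small (ℕ.>-nonZero⁻¹ n))

module FiniteSums where

  open import Data.Nat
  open import Data.Nat.Properties
  open import Data.Bool using (if_then_else_)
  open import Data.Bool using (true; false; T)
  open import Function using (_∘_)
  open import Relation.Nullary using (yes; no; contradiction)
  open import Relation.Binary.PropositionalEquality
  open import Data.Nat.Tactic.RingSolver using (solve-∀)
  open ≡-Reasoning

  ∑ : ℕ → (ℕ → ℕ) → ℕ
  ∑ zero    f = 0
  ∑ (suc n) f = f 0 + ∑ n (λ t → f (suc t))

  syntax ∑ n (λ t → e) = ∑[ t < n ] e

  ∑-cong : ∀ n {f g : ℕ → ℕ} → (∀ t → t < n → f t ≡ g t) → ∑ n f ≡ ∑ n g
  ∑-cong zero    f≡g = refl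
  ∑-cong (suc n) f≡g = cong₂ _+_ (f≡g 0 z<s) (∑-cong n (λ t t<n → f≡g (suc t) (s<s t<n)))

  ∑-zero : ∀ n {f : ℕ → ℕ} → (∀ t → t < n → f t ≡ 0) → ∑ n f ≡ 0
  ∑-zero zero    f≡0 = refl
  ∑-zero (suc n) f≡0 = cong₂ _+_ (f≡0 0 z<s) (∑-zero n (λ t t<n → f≡0 (suc t) (s<s t<n)))

  ∑-const : ∀ n c → ∑[ t < n ] c ≡ n * c
  ∑-const zero    c = refl
  ∑-const (suc n) c = cong (c +_) (∑-const n c)

  ∑-split : ∀ a b (f : ℕ → ℕ) → ∑ (a + b) f ≡ ∑ a f + ∑[ t < b ] f (a + t)
  ∑-split zero    b f = refl
  ∑-split (suc a) b f = trans (cong (f 0 +_) (∑-split a b (λ t → f (suc t)))) (sym (+-assoc (f 0) _ _))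

  ∑-last : ∀ n (f : ℕ → ℕ) → ∑ (suc n) f ≡ ∑ n f + f n
  ∑-last n f = begin
    ∑ (suc n) f          ≡⟨ cong (λ k → ∑ k f) (+-comm 1 n) ⟩
    ∑ (n + 1) f          ≡⟨ ∑-split n 1 f ⟩
    ∑ n f + (f (n + 0) + 0) ≡⟨ cong (∑ n f +_) (trans (+-identityʳ _) (cong f (+-identityʳ n))) ⟩
    ∑ n f + f n          ∎

  ∑-reverse : ∀ n (f : ℕ → ℕ) → ∑[ t < n ] f (n ∸ suc t) ≡ ∑ n f
  ∑-reverse zero    f = refl
  ∑-reverse (suc n) f = begin
    f n + ∑[ t < n ] f (n ∸ suc t) ≡⟨ cong (f n +_) (∑-reverse n f) ⟩
    f n + ∑ n f                    ≡⟨ +-comm (f n) _ ⟩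
    ∑ n f + f n                    ≡⟨ ∑-last n f ⟨
    ∑ (suc n) f                    ∎

  ∑-+ : ∀ n (f g : ℕ → ℕ) → ∑[ t < n ] (f t + g t) ≡ ∑ n f + ∑ n g
  ∑-+ zero    f g = refl
  ∑-+ (suc n) f g = trans (cong (f 0 + g 0 +_) (∑-+ n _ _)) (+-exchange (f 0) (g 0) _ _)
    where
      +-exchange : ∀ a b c d → a + b + (c + d) ≡ a + c + (b + d)
      +-exchange = solve-∀

  ∑-*ʳ : ∀ n (f : ℕ → ℕ) c → ∑[ t < n ] (f t * c) ≡ ∑ n f * c
  ∑-*ʳ zero    f c = refl
  ∑-*ʳ (suc n) f c = trans (cong (f 0 * c +_) (∑-*ʳ n _ c)) (sym (*-distribʳ-+ c (f 0) _))

  ∑-*ˡ : ∀ n c (f : ℕ → ℕ) → ∑[ t < n ] (c * f t) ≡ c * ∑ n f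
  ∑-*ˡ n c f = begin
    ∑[ t < n ] (c * f t) ≡⟨ ∑-cong n (λ t _ → *-comm c (f t)) ⟩
    ∑[ t < n ] (f t * c) ≡⟨ ∑-*ʳ n f c ⟩
    ∑ n f * c            ≡⟨ *-comm (∑ n f) c ⟩
    c * ∑ n f            ∎

  ∑-comm : ∀ a b (f : ℕ → ℕ → ℕ) → ∑[ x < a ] ∑[ y < b ] f x y ≡ ∑[ y < b ] ∑[ x < a ] f x y
  ∑-comm zero    b f = sym (∑-zero b (λ _ _ → refl))
  ∑-comm (suc a) b f = trans (cong (∑ b (f 0) +_) (∑-comm a b (λ x → f (suc x)))) (sym (∑-+ b (f 0) _))

  ∑-periodic : ∀ M (f : ℕ → ℕ) → (∀ t → f (M + t) ≡ f t) → ∀ l → ∑ (l * M) f ≡ l * ∑ M f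
  ∑-periodic M f periodic zero    = refl
  ∑-periodic M f periodic (suc l) = begin
    ∑ (M + l * M) f                      ≡⟨ ∑-split M (l * M) f ⟩
    ∑ M f + ∑[ t < l * M ] f (M + t)     ≡⟨ cong (∑ M f +_) (∑-cong (l * M) (λ t _ → periodic t)) ⟩
    ∑ M f + ∑ (l * M) f                  ≡⟨ cong (∑ M f +_) (∑-periodic M f periodic l) ⟩
    ∑ M f + l * ∑ M f                    ∎

  ∑-by-residue-3 : ∀ n (f : ℕ → ℕ) → ∑ (3 * n) f ≡ ∑[ g < n ] (f (g * 3) + (f (1 + g * 3) + f (2 + g * 3)))
  ∑-by-residue-3 zero    f = refl
  ∑-by-residue-3 (suc n) f = begin
    ∑ (3 * suc n) f                          ≡⟨ cong (λ k → ∑ k f) (*-suc 3 n) ⟩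
    ∑ (3 + 3 * n) f                          ≡⟨ ∑-split 3 (3 * n) f ⟩
    f 0 + (f 1 + (f 2 + 0)) + ∑[ t < 3 * n ] f (3 + t)
      ≡⟨ cong₂ _+_ (cong (λ z → f 0 + (f 1 + z)) (+-identityʳ (f 2))) (∑-by-residue-3 n (λ t → f (3 + t))) ⟩
    _                                        ∎

  𝟙[_≡_] : ℕ → ℕ → ℕ
  𝟙[ c ≡ y ] = if c ≡ᵇ y then 1 else 0

  𝟙-yes : ∀ {c y} → c ≡ y → 𝟙[ c ≡ y ] ≡ 1
  𝟙-yes {c} {y} c≡y with c ≡ᵇ y in eq
  ... | true  = refl
  ... | false = contradiction (subst T eq (≡⇒≡ᵇ c y c≡y)) (λ ())

  𝟙-no : ∀ {c y} → c ≢ y → 𝟙[ c ≡ y ] ≡ 0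
  𝟙-no {c} {y} c≢y with c ≡ᵇ y in eq
  ... | true  = contradiction (≡ᵇ⇒≡ c y (subst T (sym eq) _)) c≢y
  ... | false = refl

  𝟙-cong : ∀ {a b c d} → (a ≡ b → c ≡ d) → (c ≡ d → a ≡ b) → 𝟙[ a ≡ b ] ≡ 𝟙[ c ≡ d ]
  𝟙-cong {a} {b} {c} {d} to from with a ≟ b | c ≟ d
  ... | yes a≡b | _       = trans (𝟙-yes a≡b) (sym (𝟙-yes (to a≡b)))
  ... | no a≢b  | yes c≡d = contradiction (from c≡d) a≢b
  ... | no a≢b  | no c≢d  = trans (𝟙-no a≢b) (sym (𝟙-no c≢d))

  𝟙-sym : ∀ a b → 𝟙[ a ≡ b ] ≡ 𝟙[ b ≡ a ]
  𝟙-sym a b = 𝟙-cong {a} {b} {b} {a} sym sym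

  ∑-𝟙-select : ∀ n {y} (Φ : ℕ → ℕ) → y < n → ∑[ h < n ] (𝟙[ h ≡ y ] * Φ h) ≡ Φ y
  ∑-𝟙-select (suc n) {y} Φ y<1+n with y ≟ n
  ... | yes refl = begin
    ∑[ h < suc n ] (𝟙[ h ≡ n ] * Φ h)  ≡⟨ ∑-last n _ ⟩
    ∑[ h < n ] (𝟙[ h ≡ n ] * Φ h) + 𝟙[ n ≡ n ] * Φ n
      ≡⟨ cong₂ _+_ (∑-zero n (λ h h<n → cong (_* Φ h) (𝟙-no (<⇒≢ h<n)))) (cong (_* Φ n) (𝟙-yes {n} refl)) ⟩
    1 * Φ n                             ≡⟨ *-identityˡ (Φ n) ⟩
    Φ n                                 ∎
  ... | no y≢n = begin
    ∑[ h < suc n ] (𝟙[ h ≡ y ] * Φ h)  ≡⟨ ∑-last n _ ⟩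
    ∑[ h < n ] (𝟙[ h ≡ y ] * Φ h) + 𝟙[ n ≡ y ] * Φ n
      ≡⟨ cong₂ _+_ (∑-𝟙-select n Φ (≤∧≢⇒< (s≤s⁻¹ y<1+n) y≢n)) (cong (_* Φ n) (𝟙-no (y≢n ∘ sym))) ⟩
    Φ y + 0                             ≡⟨ +-identityʳ (Φ y) ⟩
    Φ y                                 ∎

  ∑-𝟙 : ∀ n {w} → w < n → ∑[ t < n ] 𝟙[ w ≡ t ] ≡ 1
  ∑-𝟙 n {w} w<n = begin
    ∑[ t < n ] 𝟙[ w ≡ t ]         ≡⟨ ∑-cong n (λ t _ → trans (𝟙-sym w t) (sym (*-identityʳ _))) ⟩
    ∑[ t < n ] (𝟙[ t ≡ w ] * 1)   ≡⟨ ∑-𝟙-select n (λ _ → 1) w<n ⟩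
    1                             ∎

module TriangleSums where

  open import Data.Nat
  open import Data.Nat.Properties
  open import Data.Nat.Tactic.RingSolver using (solve-∀)
  open import Data.Product using (_,_)
  open import Relation.Binary.PropositionalEquality
  open ≡-Reasoning
  open FiniteSums

  ∑△ : ℕ → (ℕ → ℕ → ℕ) → ℕ
  ∑△ N f = ∑[ i < N ] ∑[ t < N ∸ i ] f i t

  private
    <∸⇒+< : ∀ {t i N} → t < N ∸ i → i + t < N
    <∸⇒+< {t} {i} {N} t<N∸i = subst (i + t <_) (m+[n∸m]≡n i≤N) (+-monoʳ-< i t<N∸i)
      where
        i≤N : i ≤ N
        i≤N = <⇒≤ (m∸n≢0⇒n<m (λ N∸i≡0 → n≮0 (subst (t <_) N∸i≡0 t<N∸i)))

  ∑△-cong : ∀ N {f g : ℕ → ℕ → ℕ} → (∀ i t → i + t < N → f i t ≡ g i t) → ∑△ N f ≡ ∑△ N g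
  ∑△-cong N f≡g = ∑-cong N (λ i _ → ∑-cong (N ∸ i) (λ t t<N∸i → f≡g i t (<∸⇒+< t<N∸i)))

  ∑△-last : ∀ N (f : ℕ → ℕ → ℕ) → ∑△ (suc N) f ≡ ∑△ N f + ∑[ i < suc N ] f i (N ∸ i)
  ∑△-last N f = begin
    ∑[ i < suc N ] ∑[ t < suc N ∸ i ] f i t
      ≡⟨ ∑-cong (suc N) (λ i i≤N → trans (cong (λ k → ∑ k (f i)) (+-∸-assoc 1 (s≤s⁻¹ i≤N)))
                                         (∑-last (N ∸ i) (f i))) ⟩
    ∑[ i < suc N ] (∑[ t < N ∸ i ] f i t + f i (N ∸ i))
      ≡⟨ ∑-+ (suc N) (λ i → ∑ (N ∸ i) (f i)) (λ i → f i (N ∸ i)) ⟩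
    ∑[ i < suc N ] ∑[ t < N ∸ i ] f i t + ∑[ i < suc N ] f i (N ∸ i)
      ≡⟨ cong (_+ ∑[ i < suc N ] f i (N ∸ i)) (∑-last N (λ i → ∑ (N ∸ i) (f i))) ⟩
    ∑△ N f + ∑ (N ∸ N) (f N) + ∑[ i < suc N ] f i (N ∸ i)
      ≡⟨ cong (λ k → ∑△ N f + ∑ k (f N) + ∑[ i < suc N ] f i (N ∸ i)) (n∸n≡0 N) ⟩
    ∑△ N f + 0 + ∑[ i < suc N ] f i (N ∸ i)
      ≡⟨ cong (_+ ∑[ i < suc N ] f i (N ∸ i)) (+-identityʳ (∑△ N f)) ⟩
    ∑△ N f + ∑[ i < suc N ] f i (N ∸ i) ∎

  ∑△-transpose : ∀ N (f : ℕ → ℕ → ℕ) → ∑△ N f ≡ ∑△ N (λ i t → f t i)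
  ∑△-transpose zero    f = refl
  ∑△-transpose (suc N) f = begin
    ∑△ (suc N) f                                        ≡⟨ ∑△-last N f ⟩
    ∑△ N f + ∑[ i < suc N ] f i (N ∸ i)                ≡⟨ cong₂ _+_ (∑△-transpose N f) antidiagonal ⟩
    ∑△ N (λ i t → f t i) + ∑[ i < suc N ] f (N ∸ i) i  ≡⟨ ∑△-last N (λ i t → f t i) ⟨
    ∑△ (suc N) (λ i t → f t i)                          ∎
    where
      antidiagonal : ∑[ i < suc N ] f i (N ∸ i) ≡ ∑[ i < suc N ] f (N ∸ i) i
      antidiagonal = begin
        ∑[ i < suc N ] f i (N ∸ i)
          ≡⟨ ∑-reverse (suc N) (λ i → f i (N ∸ i)) ⟨
        ∑[ t < suc N ] f (N ∸ t) (N ∸ (N ∸ t))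
          ≡⟨ ∑-cong (suc N) (λ t t≤N → cong (f (N ∸ t)) (m∸[m∸n]≡n (s≤s⁻¹ t≤N))) ⟩
        ∑[ t < suc N ] f (N ∸ t) t ∎

  ∑△-rotate : ∀ N (f : ℕ → ℕ → ℕ) → ∑△ N (λ i t → f (N ∸ suc (i + t)) i) ≡ ∑△ N f
  ∑△-rotate N f = begin
    ∑[ i < N ] ∑[ t < N ∸ i ] f (N ∸ suc (i + t)) i
      ≡⟨ ∑-cong N (λ i _ → ∑-cong (N ∸ i) (λ t _ → cong (λ k → f k i) (reindex i t))) ⟩
    ∑[ i < N ] ∑[ t < N ∸ i ] f (N ∸ i ∸ suc t) i
      ≡⟨ ∑-cong N (λ i _ → ∑-reverse (N ∸ i) (λ u → f u i)) ⟩
    ∑△ N (λ i u → f u i)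
      ≡⟨ ∑△-transpose N f ⟨
    ∑△ N f ∎
    where
      reindex : ∀ i t → N ∸ suc (i + t) ≡ N ∸ i ∸ suc t
      reindex i t = trans (cong (N ∸_) (sym (+-suc i t))) (sym (∸-+-assoc N i (suc t)))

  ∑△-∑-comm : ∀ N M (g : ℕ → ℕ → ℕ → ℕ) → ∑△ N (λ i t → ∑[ h < M ] g h i t) ≡ ∑[ h < M ] ∑△ N (g h)
  ∑△-∑-comm N M g = trans (∑-cong N (λ i _ → ∑-comm (N ∸ i) M (λ t h → g h i t)))
                          (∑-comm N M (λ i h → ∑[ t < N ∸ i ] g h i t))

  ∑△-*ʳ : ∀ N (f : ℕ → ℕ → ℕ) c → ∑△ N (λ i t → f i t * c) ≡ ∑△ N f * c
  ∑△-*ʳ N f c = trans (∑-cong N (λ i _ → ∑-*ʳ (N ∸ i) (f i) c)) (∑-*ʳ N _ c)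

  ∑△-+ : ∀ N (f g : ℕ → ℕ → ℕ) → ∑△ N (λ i t → f i t + g i t) ≡ ∑△ N f + ∑△ N g
  ∑△-+ N f g = trans (∑-cong N (λ i _ → ∑-+ (N ∸ i) (f i) (g i))) (∑-+ N _ _)

  ∑□ : ℕ → (ℕ → ℕ → ℕ) → ℕ
  ∑□ N f = ∑[ i < N ] ∑[ u < N ] f i u

  ∑□-split : ∀ N (f : ℕ → ℕ → ℕ) → ∑□ (suc N) f ≡ ∑△ (suc N) f + ∑△ N (λ i u → f (N ∸ i) (N ∸ u))
  ∑□-split N f = begin
    ∑[ i < suc N ] ∑[ u < suc N ] f i u
      ≡⟨ ∑-cong (suc N) (λ i i≤N → row i (s≤s⁻¹ i≤N)) ⟩
    ∑[ i < suc N ] (∑[ u < suc N ∸ i ] f i u + tail i)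
      ≡⟨ ∑-+ (suc N) (λ i → ∑[ u < suc N ∸ i ] f i u) tail ⟩
    ∑△ (suc N) f + ∑ (suc N) tail
      ≡⟨ cong (∑△ (suc N) f +_) tails ⟩
    ∑△ (suc N) f + ∑△ N (λ i u → f (N ∸ i) (N ∸ u)) ∎
    where
      tail : ℕ → ℕ
      tail i = ∑[ u < i ] f i (N ∸ u)
      row : ∀ i → i ≤ N → ∑[ u < suc N ] f i u ≡ ∑[ u < suc N ∸ i ] f i u + tail i
      row i i≤N = begin
        ∑ (suc N) (f i)                                ≡⟨ cong (λ k → ∑ k (f i)) (sym (m∸n+n≡m (m≤n⇒m≤1+n i≤N))) ⟩
        ∑ (suc N ∸ i + i) (f i)                        ≡⟨ ∑-split (suc N ∸ i) i (f i) ⟩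
        ∑ (suc N ∸ i) (f i) + ∑[ u < i ] f i (suc N ∸ i + u)
          ≡⟨ cong (∑ (suc N ∸ i) (f i) +_) (∑-reverse i (λ u → f i (suc N ∸ i + u))) ⟨
        ∑ (suc N ∸ i) (f i) + ∑[ u < i ] f i (suc N ∸ i + (i ∸ suc u))
          ≡⟨ cong (∑ (suc N ∸ i) (f i) +_) (∑-cong i (λ u u<i → cong (f i) (reflect u<i))) ⟩
        ∑ (suc N ∸ i) (f i) + tail i                   ∎
        where
          reflect : ∀ {u} → u < i → suc N ∸ i + (i ∸ suc u) ≡ N ∸ u
          reflect {u} u<i with m≤n⇒∃[o]m+o≡n u<i | m≤n⇒∃[o]m+o≡n i≤N
          ... | a , refl | b , refl = begin
            suc (suc u + a + b) ∸ (suc u + a) + (suc u + a ∸ suc u)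
              ≡⟨ cong₂ _+_ (+-∸-assoc 1 (m≤m+n (suc u + a) b)) (m+n∸m≡n (suc u) a) ⟩
            suc (suc u + a + b ∸ (suc u + a)) + a                     ≡⟨ cong (λ k → suc k + a) (m+n∸m≡n (suc u + a) b) ⟩
            suc b + a                                                 ≡⟨ m+n∸m≡n u (suc b + a) ⟨
            u + (suc b + a) ∸ u                                       ≡⟨ cong (_∸ u) (reorder u a b) ⟩
            suc (u + a + b) ∸ u                                       ∎
            where
              reorder : ∀ u a b → u + (suc b + a) ≡ suc (u + a + b)
              reorder = solve-∀
      tails : ∑ (suc N) tail ≡ ∑△ N (λ i u → f (N ∸ i) (N ∸ u))
      tails = begin
        ∑ (suc N) tail                                 ≡⟨ ∑-reverse (suc N) tail ⟨
        ∑[ i < suc N ] tail (N ∸ i)                    ≡⟨ ∑-last N _ ⟩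
        ∑△ N (λ i u → f (N ∸ i) (N ∸ u)) + tail (N ∸ N)
                                                       ≡⟨ cong (λ k → ∑△ N (λ i u → f (N ∸ i) (N ∸ u)) + tail k) (n∸n≡0 N) ⟩
        ∑△ N (λ i u → f (N ∸ i) (N ∸ u)) + 0           ≡⟨ +-identityʳ _ ⟩
        ∑△ N (λ i u → f (N ∸ i) (N ∸ u))               ∎

module AffineCount (M : ℕ) .{{_ : NonZero M}} where

  open import Data.Integer using (+_; -_; _+_; _-_; _*_)
  import Data.Integer.Properties as ℤP
  open import Data.Integer.Tactic.RingSolver using (solve-∀)
  open import Relation.Binary.PropositionalEquality
  open import Defs using (π)
  open Modular
  open FiniteSums
  open Congruence (+ M)
  open Reduction M

  𝟙-affine-solve : ∀ a c {h} → ((unit b _) : IsUnit (+ M) a) → h ℕ.< M → ∀ y →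
                   𝟙[ h ≡ π M (c + a * y) ] ≡ 𝟙[ π M (b * (+ h - c)) ≡ π M y ]
  𝟙-affine-solve a c {h} (unit b ab≡1) h<M y = 𝟙-cong solution solves
    where
      open ≡-mod-Reasoning
      cancel-offset : ∀ a b c y → b * ((c + a * y) - c) ≡ (a * b) * y
      cancel-offset = solve-∀
      offset-identity : ∀ c h → h ≡ c + + 1 * (h - c)
      offset-identity = solve-∀
      reassociate : ∀ a b c h → c + (a * b) * (h - c) ≡ c + a * (b * (h - c))
      reassociate = solve-∀
      solution : h ≡ π M (c + a * y) → π M (b * (+ h - c)) ≡ π M y
      solution h≡ = π-cong (begin
        b * (+ h - c)               ≈⟨ *-congˡ b (+-congʳ (- c) (≡π⇒≡-mod (c + a * y) h≡)) ⟩
        b * ((c + a * y) - c)       ≡⟨ cancel-offset a b c y ⟩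
        (a * b) * y                 ≈⟨ *-congʳ y ab≡1 ⟩
        + 1 * y                     ≡⟨ ℤP.*-identityˡ y ⟩
        y                           ∎)
      solves : π M (b * (+ h - c)) ≡ π M y → h ≡ π M (c + a * y)
      solves w≡πy = trans (sym (π-small h<M)) (π-cong (begin
        + h                         ≡⟨ offset-identity c (+ h) ⟩
        c + + 1 * (+ h - c)         ≈⟨ +-congˡ c (*-congʳ (+ h - c) ab≡1) ⟨
        c + (a * b) * (+ h - c)     ≡⟨ reassociate a b c (+ h) ⟩
        c + a * (b * (+ h - c))     ≈⟨ +-congˡ c (*-congˡ a (π-injective w≡πy)) ⟩
        c + a * y                   ∎))

  ∑-𝟙-affine : ∀ a c {h} → IsUnit (+ M) a → h ℕ.< M →
               ∑[ t < M ] 𝟙[ h ≡ π M (c + a * + t) ] ≡ 1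
  ∑-𝟙-affine a c {h} (unit b ab≡1) h<M = begin
    ∑[ t < M ] 𝟙[ h ≡ π M (c + a * + t) ]
      ≡⟨ ∑-cong M (λ t t<M → trans (𝟙-affine-solve a c (unit b ab≡1) h<M (+ t))
                                   (cong 𝟙[ π M (b * (+ h - c)) ≡_] (π-small t<M))) ⟩
    ∑[ t < M ] 𝟙[ π M (b * (+ h - c)) ≡ t ]        ≡⟨ ∑-𝟙 M (π< (b * (+ h - c))) ⟩
    1                                             ∎
    where open ≡-Reasoning

module TriangleDifferences (M : ℕ) .{{_ : NonZero M}} (w : ℕ) (M≡1+2w : M ≡ ℕ.suc (2 ℕ.* w)) where

  open import Data.Nat using (suc; _∸_; z<s)
  import Data.Nat.Properties as ℕP
  open import Data.Integer using (+_; -_; _+_; _-_; _*_)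
  open import Data.Integer.Divisibility.Signed using (divides)
  import Data.Integer.Properties as ℤP
  open import Data.Integer.Tactic.RingSolver using (solve-∀)
  open import Relation.Binary.PropositionalEquality
  open import Defs using (π)
  open Modular
  open Congruence (+ M)
  open Reduction M
  open FiniteSums
  open TriangleSums
  open AffineCount M
  open IntegerCasts
  open ≡-Reasoning

  cell : ℕ → ℕ → ℕ → ℕ
  cell h i t = 𝟙[ h ≡ π M (+ t - + i) ]

  differences : ℕ → ℕ → ℕ
  differences N h = ∑△ N (cell h)

  private
    cell-affine : ∀ h i t → cell h i t ≡ 𝟙[ h ≡ π M (- + i + + 1 * + t) ]
    cell-affine h i t = cong (λ d → 𝟙[ h ≡ π M d ]) (as-affine (+ t) (+ i))
      where
        as-affine : ∀ t i → t - i ≡ - i + + 1 * t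
        as-affine = solve-∀

    cell-periodic : ∀ h i t → cell h i (M ℕ.+ t) ≡ cell h i t
    cell-periodic h i t = cong 𝟙[ h ≡_] (trans (cong (π M) shift) (π-+-multiple (+ t - + i) (+ 1)))
      where
        rearrange : ∀ t i m → (m + t) - i ≡ (t - i) + + 1 * m
        rearrange = solve-∀
        shift : + (M ℕ.+ t) - + i ≡ (+ t - + i) + + 1 * + M
        shift = trans (cong (_- + i) (ℤP.pos-+ M t)) (rearrange (+ t) (+ i) (+ M))

    row-count : ∀ {h} → h ℕ.< M → ∀ l i → ∑[ t < l ℕ.* M ] cell h i t ≡ l
    row-count {h} h<M l i = begin
      ∑[ t < l ℕ.* M ] cell h i t                      ≡⟨ ∑-periodic M (cell h i) (cell-periodic h i) l ⟩
      l ℕ.* ∑[ t < M ] cell h i t                      ≡⟨ cong (l ℕ.*_) (∑-cong M (λ t _ → cell-affine h i t)) ⟩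
      l ℕ.* ∑[ t < M ] 𝟙[ h ≡ π M (- + i + + 1 * + t) ]
                                                       ≡⟨ cong (l ℕ.*_) (∑-𝟙-affine (+ 1) (- + i) (unit (+ 1) ≡-mod-refl) h<M) ⟩
      l ℕ.* 1                                          ≡⟨ ℕP.*-identityʳ l ⟩
      l                                                ∎

    -2-unit : IsUnit (+ M) (- + 2)
    -2-unit = unit (- + suc w) (≡-mod (divides (+ 1) (trans (identity (+ w)) (cong (_*_ (+ 1)) (sym +M≡1+2w)))))
      where
        identity : ∀ w → - + 2 * - (+ 1 + w) - + 1 ≡ + 1 * (+ 1 + + 2 * w)
        identity = solve-∀
        +M≡1+2w : + M ≡ + 1 + + 2 * + w
        +M≡1+2w = trans (cong +_ M≡1+2w) (cong (_+_ (+ 1)) (ℤP.pos-* 2 w))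

    antidiagonal-count : ∀ {h} → h ℕ.< M → ∀ l N → suc N ≡ l ℕ.* M → ∑[ i < suc N ] cell h i (N ∸ i) ≡ l
    antidiagonal-count {h} h<M l N 1+N≡lM = begin
      ∑[ i < suc N ] cell h i (N ∸ i)
        ≡⟨ ∑-cong (suc N) (λ i i≤N → cong (λ d → 𝟙[ h ≡ π M d ]) (as-affine i (ℕ.s≤s⁻¹ i≤N))) ⟩
      ∑[ i < suc N ] g i              ≡⟨ cong (λ k → ∑ k g) 1+N≡lM ⟩
      ∑[ i < l ℕ.* M ] g i            ≡⟨ ∑-periodic M g periodic l ⟩
      l ℕ.* ∑[ i < M ] g i            ≡⟨ cong (l ℕ.*_) (∑-𝟙-affine (- + 2) (+ N) -2-unit h<M) ⟩
      l ℕ.* 1                         ≡⟨ ℕP.*-identityʳ l ⟩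
      l                               ∎
      where
        g : ℕ → ℕ
        g i = 𝟙[ h ≡ π M (+ N + - + 2 * + i) ]
        rearrange₁ : ∀ n i → n - i - i ≡ n + - + 2 * i
        rearrange₁ = solve-∀
        rearrange₂ : ∀ n i m → n + - + 2 * (m + i) ≡ (n + - + 2 * i) + - + 2 * m
        rearrange₂ = solve-∀
        as-affine : ∀ i → i ℕ.≤ N → + (N ∸ i) - + i ≡ + N + - + 2 * + i
        as-affine i i≤N = trans (cong (_- + i) (pos-∸ i≤N)) (rearrange₁ (+ N) (+ i))
        periodic : ∀ i → g (M ℕ.+ i) ≡ g i
        periodic i = cong 𝟙[ h ≡_] (begin
          π M (+ N + - + 2 * + (M ℕ.+ i))           ≡⟨ cong (λ x → π M (+ N + - + 2 * x)) (ℤP.pos-+ M i) ⟩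
          π M (+ N + - + 2 * (+ M + + i))           ≡⟨ cong (π M) (rearrange₂ (+ N) (+ i) (+ M)) ⟩
          π M ((+ N + - + 2 * + i) + - + 2 * + M)   ≡⟨ π-+-multiple (+ N + - + 2 * + i) (- + 2) ⟩
          π M (+ N + - + 2 * + i)                   ∎)

    reflected : ∀ h N → ∑△ N (λ i u → cell h (N ∸ i) (N ∸ u)) ≡ differences N h
    reflected h N = begin
      ∑△ N (λ i u → cell h (N ∸ i) (N ∸ u))
        ≡⟨ ∑△-cong N (λ i u i+u<N → cong (λ d → 𝟙[ h ≡ π M d ]) (difference {i} {u} i+u<N)) ⟩
      ∑△ N (λ i u → cell h u i)             ≡⟨ ∑△-transpose N (cell h) ⟨
      differences N h                       ∎
      where
        cancel : ∀ n i u → (n - u) - (n - i) ≡ i - u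
        cancel = solve-∀
        difference : ∀ {i u} → i ℕ.+ u ℕ.< N → + (N ∸ u) - + (N ∸ i) ≡ + i - + u
        difference {i} {u} i+u<N = begin
          + (N ∸ u) - + (N ∸ i)
            ≡⟨ cong₂ _-_ (pos-∸ (ℕP.m+n≤o⇒n≤o i (ℕP.<⇒≤ i+u<N))) (pos-∸ (ℕP.m+n≤o⇒m≤o i (ℕP.<⇒≤ i+u<N))) ⟩
          (+ N - + u) - (+ N - + i) ≡⟨ cancel (+ N) (+ i) (+ u) ⟩
          + i - + u                 ∎

    -- The square of side N + 1 is the triangle of size N + 1 plus a reflected copy of the triangle of
    -- size N; every row of the square, and the antidiagonal closing the larger triangle (because −2 is
    -- a unit modulo the odd M), contains l cells with t − i ≡ h.
    twice-differences : ∀ {h} → h ℕ.< M → ∀ l N → suc N ≡ l ℕ.* M →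
                        differences (suc N) h ℕ.+ differences (suc N) h ≡ l ℕ.* M ℕ.* l ℕ.+ l
    twice-differences {h} h<M l N 1+N≡lM = begin
      D (suc N) ℕ.+ D (suc N)
        ≡⟨ cong (D (suc N) ℕ.+_) (∑△-last N (cell h)) ⟩
      D (suc N) ℕ.+ (D N ℕ.+ ∑[ i < suc N ] cell h i (N ∸ i))
        ≡⟨ cong (λ a → D (suc N) ℕ.+ (D N ℕ.+ a)) (antidiagonal-count h<M l N 1+N≡lM) ⟩
      D (suc N) ℕ.+ (D N ℕ.+ l)
        ≡⟨ ℕP.+-assoc (D (suc N)) (D N) l ⟨
      D (suc N) ℕ.+ D N ℕ.+ l
        ≡⟨ cong (λ a → D (suc N) ℕ.+ a ℕ.+ l) (reflected h N) ⟨
      ∑△ (suc N) (cell h) ℕ.+ ∑△ N (λ i u → cell h (N ∸ i) (N ∸ u)) ℕ.+ l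
        ≡⟨ cong (ℕ._+ l) (∑□-split N (cell h)) ⟨
      ∑□ (suc N) (cell h) ℕ.+ l
        ≡⟨ cong (λ k → ∑□ k (cell h) ℕ.+ l) 1+N≡lM ⟩
      ∑□ (l ℕ.* M) (cell h) ℕ.+ l
        ≡⟨ cong (ℕ._+ l) (∑-cong (l ℕ.* M) (λ i _ → row-count h<M l i)) ⟩
      ∑[ i < l ℕ.* M ] l ℕ.+ l
        ≡⟨ cong (ℕ._+ l) (∑-const (l ℕ.* M) l) ⟩
      l ℕ.* M ℕ.* l ℕ.+ l ∎
      where
        D : ℕ → ℕ
        D N = differences N h

  differences-uniform : ∀ l {h} → h ℕ.< M → differences (l ℕ.* M) h ≡ differences (l ℕ.* M) 0
  differences-uniform ℕ.zero    h<M = refl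
  differences-uniform (suc l) {h} h<M =
    subst (λ N → differences N h ≡ differences N 0) 1+N≡lM
      (double-injective (trans (twice-differences h<M (suc l) N 1+N≡lM) (sym (twice-differences 0<M (suc l) N 1+N≡lM))))
    where
      N = 2 ℕ.* w ℕ.+ l ℕ.* M
      1+N≡lM : suc N ≡ suc l ℕ.* M
      1+N≡lM = cong (ℕ._+ l ℕ.* M) (sym M≡1+2w)
      0<M : 0 ℕ.< M
      0<M = subst (0 ℕ.<_) (sym M≡1+2w) z<s
      double-injective : ∀ {a b} → a ℕ.+ a ≡ b ℕ.+ b → a ≡ b
      double-injective {a} {b} a+a≡b+b =
        ℕP.*-cancelˡ-≡ a b 2 (trans (cong (a ℕ.+_) (ℕP.+-identityʳ a)) (trans a+a≡b+b (cong (b ℕ.+_) (sym (ℕP.+-identityʳ b)))))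

  ∑△-by-difference : ∀ l (φ : ℕ → ℕ) →
                     ∑△ (l ℕ.* M) (λ i t → φ (π M (+ t - + i))) ≡ differences (l ℕ.* M) 0 ℕ.* ∑ M φ
  ∑△-by-difference l φ = begin
    ∑△ N (λ i t → φ (π M (+ t - + i)))
      ≡⟨ ∑△-cong N (λ i t _ → sym (∑-𝟙-select M φ (π< (+ t - + i)))) ⟩
    ∑△ N (λ i t → ∑[ h < M ] (cell h i t ℕ.* φ h))
      ≡⟨ ∑△-∑-comm N M (λ h i t → cell h i t ℕ.* φ h) ⟩
    ∑[ h < M ] ∑△ N (λ i t → cell h i t ℕ.* φ h)
      ≡⟨ ∑-cong M (λ h h<M → trans (∑△-*ʳ N (cell h) (φ h)) (cong (ℕ._* φ h) (differences-uniform l h<M))) ⟩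
    ∑[ h < M ] (differences N 0 ℕ.* φ h)
      ≡⟨ ∑-*ˡ M (differences N 0) φ ⟩
    differences N 0 ℕ.* ∑ M φ ∎
    where
      N = l ℕ.* M

module Multiplicities where

  open import Data.Nat using (zero; suc; _+_; _≡ᵇ_)
  import Data.Nat.Properties as ℕP
  open import Data.Integer using (+_; -_; _-_)
  open import Data.Bool using (true; false)
  open import Data.List using (_∷_; _++_; length; applyUpTo; filter)
  open import Data.List.Properties using (filter-++; length-++; map-upTo; length-applyUpTo)
  open import Relation.Binary.PropositionalEquality
  open import Defs using (π; orbit; prefix; nextRow; triangleAux; ∇; mult)
  open FiniteSums
  open TriangleSums
  open ≡-Reasoning

  mult-∷ : ∀ c y xs → mult c (y ∷ xs) ≡ 𝟙[ c ≡ y ] + mult c xs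
  mult-∷ c y xs with c ≡ᵇ y
  ... | true  = refl
  ... | false = refl

  mult-++ : ∀ c xs ys → mult c (xs ++ ys) ≡ mult c xs + mult c ys
  mult-++ c xs ys = trans (cong length (filter-++ (c ℕ.≟_) xs ys)) (length-++ (filter (c ℕ.≟_) xs))

  mult-applyUpTo : ∀ c L f → mult c (applyUpTo f L) ≡ ∑[ t < L ] 𝟙[ c ≡ f t ]
  mult-applyUpTo c zero    f = refl
  mult-applyUpTo c (suc L) f = trans (mult-∷ c (f 0) _) (cong (_+_ 𝟙[ c ≡ f 0 ]) (mult-applyUpTo c L _))

  applyUpTo-cong : ∀ L {f g : ℕ → ℕ} → (∀ t → f t ≡ g t) → applyUpTo f L ≡ applyUpTo g L
  applyUpTo-cong zero    f≡g = refl
  applyUpTo-cong (suc L) f≡g = cong₂ _∷_ (f≡g 0) (applyUpTo-cong L (λ t → f≡g (suc t)))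

  module _ (m : ℕ) .{{_ : NonZero m}} (u : ℤ → ℕ) where

    row : ℕ → ℕ → ℕ
    row i t = orbit m u i (+ t)

    nextRow-applyUpTo : ∀ L (f : ℕ → ℕ) →
                        nextRow m (applyUpTo f (suc L)) ≡ applyUpTo (λ t → π m (- (+ f t) - + f (suc t))) L
    nextRow-applyUpTo zero    f = refl
    nextRow-applyUpTo (suc L) f = cong (π m (- (+ f 0) - + f 1) ∷_) (nextRow-applyUpTo L (λ t → f (suc t)))

    nextRow-row : ∀ i L → nextRow m (applyUpTo (row i) (suc L)) ≡ applyUpTo (row (suc i)) L
    nextRow-row i L = trans (nextRow-applyUpTo L (row i))
      (applyUpTo-cong L (λ t → cong (λ j → π m (- (+ row i t) - + orbit m u i (+ j))) (ℕP.+-comm 1 t)))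

    mult-triangleAux : ∀ c L i →
                       mult c (triangleAux m L (applyUpTo (row i) L)) ≡ ∑△ L (λ i′ t → 𝟙[ c ≡ row (i′ + i) t ])
    mult-triangleAux c zero    i = refl
    mult-triangleAux c (suc L) i = begin
      mult c (applyUpTo (row i) (suc L) ++ triangleAux m L (nextRow m (applyUpTo (row i) (suc L))))
        ≡⟨ mult-++ c (applyUpTo (row i) (suc L)) _ ⟩
      mult c (applyUpTo (row i) (suc L)) + mult c (triangleAux m L (nextRow m (applyUpTo (row i) (suc L))))
        ≡⟨ cong₂ _+_ (mult-applyUpTo c (suc L) (row i)) (cong (λ xs → mult c (triangleAux m L xs)) (nextRow-row i L)) ⟩
      (∑[ t < suc L ] 𝟙[ c ≡ row i t ]) + mult c (triangleAux m L (applyUpTo (row (suc i)) L))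
        ≡⟨ cong (∑ (suc L) (λ t → 𝟙[ c ≡ row i t ]) ℕ.+_) (trans (mult-triangleAux c L (suc i))
             (∑△-cong L (λ i′ t _ → cong (λ k → 𝟙[ c ≡ row k t ]) (ℕP.+-suc i′ i)))) ⟩
      ∑△ (suc L) (λ i′ t → 𝟙[ c ≡ row (i′ + i) t ]) ∎

    mult-∇ : ∀ c n → mult c (∇ m (prefix u n)) ≡ ∑△ n (λ i t → 𝟙[ c ≡ orbit m u i (+ t) ])
    mult-∇ c n = begin
      mult c (∇ m (prefix u n))
        ≡⟨ cong (λ xs → mult c (triangleAux m (length xs) xs)) (map-upTo (λ t → u (+ t)) n) ⟩
      mult c (triangleAux m (length (applyUpTo (row 0) n)) (applyUpTo (row 0) n))
        ≡⟨ cong (λ k → mult c (triangleAux m k (applyUpTo (row 0) n))) (length-applyUpTo (row 0) n) ⟩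
      mult c (triangleAux m n (applyUpTo (row 0) n))
        ≡⟨ mult-triangleAux c n 0 ⟩
      ∑△ n (λ i t → 𝟙[ c ≡ row (i + 0) t ])
        ≡⟨ ∑△-cong n (λ i t _ → cong (λ k → 𝟙[ c ≡ row k t ]) (ℕP.+-identityʳ i)) ⟩
      ∑△ n (λ i t → 𝟙[ c ≡ orbit m u i (+ t) ]) ∎

module Slots where

  open import Data.Fin using (zero; suc; fromℕ<)
  open import Data.Fin.Properties using (toℕ<n; toℕ-injective; toℕ-fromℕ<)
  open import Data.Integer using (+_; -_; _+_; _-_; _*_; _/ℕ_)
  import Data.Integer.Properties as ℤP
  open import Data.Integer.DivMod using (a≡a%ℕn+[a/ℕn]*n)
  open import Data.Integer.Tactic.RingSolver using (solve-∀)
  open import Data.Product using (_×_; _,_; proj₂; Σ-syntax)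
  open import Data.Integer.Divisibility.Signed using (divides)
  open import Relation.Binary.PropositionalEquality
  open import Function using (_∘_)
  open import Defs using (π)
  open Modular
  open Reduction 3

  Slot : Set
  Slot = ℤ × Fin 3

  offset : Slot → ℤ
  offset (k , r) = + toℕ r + k * + 3

  next : Slot → Slot
  next (k , zero)             = k , suc zero
  next (k , suc zero)         = k , suc (suc zero)
  next (k , suc (suc zero))   = k + + 1 , zero

  private
    within-block : ∀ r k → r + + 1 + k * + 3 ≡ r + k * + 3 + + 1
    within-block = solve-∀

    carry : ∀ k → + 0 + (k + + 1) * + 3 ≡ + 2 + k * + 3 + + 1
    carry = solve-∀

  offset-next : ∀ s → offset (next s) ≡ offset s + + 1
  offset-next (k , zero)           = within-block (+ 0) k
  offset-next (k , suc zero)       = within-block (+ 1) k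
  offset-next (k , suc (suc zero)) = carry k

  split : ℤ → Slot
  split d = d /ℕ 3 , fromℕ< (π< d)

  offset-split : ∀ d → offset (split d) ≡ d
  offset-split d = trans (cong (λ r → + r + d /ℕ 3 * + 3) (toℕ-fromℕ< (π< d))) (sym (a≡a%ℕn+[a/ℕn]*n d 3))

  offset-injective : ∀ {s s′} → offset s ≡ offset s′ → s ≡ s′
  offset-injective {k , r} {k′ , r′} eq = cong₂ _,_ k≡k′ r≡r′
    where
      open ≡-Reasoning
      r≡r′ : r ≡ r′
      r≡r′ = toℕ-injective (begin
        toℕ r                        ≡⟨ π-small (toℕ<n r) ⟨
        π 3 (+ toℕ r)                ≡⟨ π-+-multiple (+ toℕ r) k ⟨
        π 3 (offset (k , r))         ≡⟨ cong (π 3) eq ⟩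
        π 3 (offset (k′ , r′))       ≡⟨ π-+-multiple (+ toℕ r′) k′ ⟩
        π 3 (+ toℕ r′)               ≡⟨ π-small (toℕ<n r′) ⟩
        toℕ r′                       ∎)
      cancelˡ : ∀ x {a b} → x + a ≡ x + b → a ≡ b
      cancelˡ x {a} {b} eq = trans (difference x a) (trans (cong (_- x) eq) (sym (difference x b)))
        where
          difference : ∀ x a → a ≡ (x + a) - x
          difference = solve-∀
      k≡k′ : k ≡ k′
      k≡k′ = ℤP.*-cancelʳ-≡ k k′ (+ 3) (cancelˡ (+ toℕ r) (trans eq (cong (λ r → + toℕ r + k′ * + 3) (sym r≡r′))))

  position-suc : ∀ {i j} s → j ≡ i + offset s → j + + 1 ≡ i + offset (next s)
  position-suc {i} {j} s refl = trans (ℤP.+-assoc i (offset s) (+ 1)) (cong (_+_ i) (sym (offset-next s)))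

  position-next-row : ∀ {i j} s → j ≡ + 1 + i + offset s → j ≡ i + offset (next s)
  position-next-row {i} {j} s refl = trans (reorder i (offset s)) (cong (_+_ i) (sym (offset-next s)))
    where
      reorder : ∀ i o → + 1 + i + o ≡ i + (o + + 1)
      reorder = solve-∀

  position : ∀ i j → j ≡ i + offset (split (j - i))
  position i j = trans (x≡y+[x-y] j i) (cong (_+_ i) (sym (offset-split (j - i))))
    where
      x≡y+[x-y] : ∀ x y → x ≡ y + (x - y)
      x≡y+[x-y] = solve-∀

  position-block-shift : ∀ i {j} k r d → j ≡ i + offset (k , r) → j + + 3 * d ≡ i + offset (k + d , r)
  position-block-shift i k r d refl = shift i (+ toℕ r) k d
    where
      shift : ∀ i r k d → i + (r + k * + 3) + + 3 * d ≡ i + (r + (k + d) * + 3)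
      shift = solve-∀

  position-row-shift : ∀ i {j} k r d → j ≡ i + offset (k , r) → j ≡ (i + + 3 * d) + offset (k - d , r)
  position-row-shift i k r d refl = shift i (+ toℕ r) k d
    where
      shift : ∀ i r k d → i + (r + k * + 3) ≡ (i + + 3 * d) + (r + (k - d) * + 3)
      shift = solve-∀

  cycle : Fin 3 → Fin 3
  cycle zero             = suc zero
  cycle (suc zero)       = suc (suc zero)
  cycle (suc (suc zero)) = zero

  cycle-injective : ∀ {a b} → cycle a ≡ cycle b → a ≡ b
  cycle-injective {a} {b} eq = trans (sym (cycle³ a)) (trans (cong (cycle ∘ cycle) eq) (cycle³ b))
    where
      cycle³ : ∀ a → cycle (cycle (cycle a)) ≡ a
      cycle³ zero             = refl
      cycle³ (suc zero)       = refl
      cycle³ (suc (suc zero)) = refl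

  residue-next : ∀ s → proj₂ (next s) ≡ cycle (proj₂ s)
  residue-next (k , zero)           = refl
  residue-next (k , suc zero)       = refl
  residue-next (k , suc (suc zero)) = refl

  shift-block : Slot → ℤ → Slot
  shift-block (k , r) d = k + d , r

  offset-shift-block : ∀ s d → offset (shift-block s d) ≡ offset s + + 3 * d
  offset-shift-block (k , r) d = distribute (+ toℕ r) k d
    where
      distribute : ∀ r k d → r + (k + d) * + 3 ≡ r + k * + 3 + + 3 * d
      distribute = solve-∀

  rotate-offset : ∀ i t L s → t ≡ i + offset s → i ≡ (L * + 3 - (+ 1 + i + t)) + offset (shift-block (next s) (i - L))
  rotate-offset i t L s refl = begin
    i                                                          ≡⟨ rearrange i L (offset s) ⟩
    (L * + 3 - (+ 1 + i + (i + offset s))) + ((offset s + + 1) + + 3 * (i - L))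
      ≡⟨ cong (λ o → (L * + 3 - (+ 1 + i + (i + offset s))) + (o + + 3 * (i - L))) (offset-next s) ⟨
    (L * + 3 - (+ 1 + i + (i + offset s))) + (offset (next s) + + 3 * (i - L))
      ≡⟨ cong (_+_ (L * + 3 - (+ 1 + i + (i + offset s)))) (offset-shift-block (next s) (i - L)) ⟨
    (L * + 3 - (+ 1 + i + (i + offset s))) + offset (shift-block (next s) (i - L)) ∎
    where
      open ≡-Reasoning
      rearrange : ∀ i L o → i ≡ (L * + 3 - (+ 1 + i + (i + o))) + ((o + + 1) + + 3 * (i - L))
      rearrange = solve-∀

  split-mod : ∀ {d d′} M → d ≡ d′ [mod M * + 3 ] → Σ[ q ∈ ℤ ] split d ≡ shift-block (split d′) (q * M)
  split-mod {d} {d′} M (≡-mod (divides q d-d′≡)) = q , offset-injective {split d} {shift-block (split d′) (q * M)} (begin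
    offset (split d)                            ≡⟨ offset-split d ⟩
    d                                           ≡⟨ x≡y+[x-y] d d′ ⟩
    d′ + (d - d′)                               ≡⟨ cong₂ _+_ (sym (offset-split d′)) d-d′≡ ⟩
    offset (split d′) + q * (M * + 3)           ≡⟨ cong (_+_ (offset (split d′))) (reassociate q M) ⟩
    offset (split d′) + + 3 * (q * M)           ≡⟨ offset-shift-block (split d′) (q * M) ⟨
    offset (shift-block (split d′) (q * M))     ∎)
    where
      open ≡-Reasoning
      x≡y+[x-y] : ∀ x y → x ≡ y + (x - y)
      x≡y+[x-y] = solve-∀
      reassociate : ∀ q M → q * (M * + 3) ≡ + 3 * (q * M)
      reassociate = solve-∀

module ClosedForm where

  open import Data.Fin using (zero; suc)
  open import Data.Integer using (+_; -_; _+_; _-_; _*_)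
  open import Data.Integer.Tactic.RingSolver using (solve-∀)
  open import Data.Product using (_,_; proj₂)
  open import Relation.Binary.PropositionalEquality
  open Modular
  open Slots

  ε : Fin 3 → ℤ
  ε zero             = + 1
  ε (suc zero)       = + 0
  ε (suc (suc zero)) = - + 1

  γ : ℤ → Slot → ℤ
  γ i (k , zero)             = - k
  γ i (k , suc zero)         = + 2 * k + + 1 + i
  γ i (k , suc (suc zero))   = - (k + + 1 + i)

  closed : ℤ → ℤ → ℤ → Slot → ℤ
  closed a₁ a₂ i s = a₁ * ε (proj₂ s) + a₂ * γ i s

  slope : Fin 3 → ℤ
  slope zero             = - + 1
  slope (suc zero)       = + 2
  slope (suc (suc zero)) = - + 1

  γ-block-shift : ∀ i k d r → γ i (k + d , r) ≡ γ i (k , r) + slope r * d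
  γ-block-shift i k d zero             = shift₀ k d
    where
      shift₀ : ∀ k d → - (k + d) ≡ - k + - + 1 * d
      shift₀ = solve-∀
  γ-block-shift i k d (suc zero)       = shift₁ i k d
    where
      shift₁ : ∀ i k d → + 2 * (k + d) + + 1 + i ≡ + 2 * k + + 1 + i + + 2 * d
      shift₁ = solve-∀
  γ-block-shift i k d (suc (suc zero)) = shift₂ i k d
    where
      shift₂ : ∀ i k d → - (k + d + + 1 + i) ≡ - (k + + 1 + i) + - + 1 * d
      shift₂ = solve-∀

  closed-recurrence : ∀ a₁ a₂ i s →
                      - closed a₁ a₂ i (next s) - closed a₁ a₂ i (next (next s)) ≡ closed a₁ a₂ (+ 1 + i) s
  closed-recurrence a₁ a₂ i (k , zero)           = recurrence₀ a₁ a₂ i k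
    where
      recurrence₀ : ∀ a₁ a₂ i k → - (a₁ * + 0 + a₂ * (+ 2 * k + + 1 + i)) - (a₁ * - + 1 + a₂ * - (k + + 1 + i))
                                  ≡ a₁ * + 1 + a₂ * - k
      recurrence₀ = solve-∀
  closed-recurrence a₁ a₂ i (k , suc zero)       = recurrence₁ a₁ a₂ i k
    where
      recurrence₁ : ∀ a₁ a₂ i k → - (a₁ * - + 1 + a₂ * - (k + + 1 + i)) - (a₁ * + 1 + a₂ * - (k + + 1))
                                  ≡ a₁ * + 0 + a₂ * (+ 2 * k + + 1 + (+ 1 + i))
      recurrence₁ = solve-∀
  closed-recurrence a₁ a₂ i (k , suc (suc zero)) = recurrence₂ a₁ a₂ i k
    where
      recurrence₂ : ∀ a₁ a₂ i k → - (a₁ * + 1 + a₂ * - (k + + 1)) - (a₁ * + 0 + a₂ * (+ 2 * (k + + 1) + + 1 + i))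
                                  ≡ a₁ * - + 1 + a₂ * - (k + + 1 + (+ 1 + i))
      recurrence₂ = solve-∀

  closed-block-periodic : ∀ a₁ a₂ i k d r → closed a₁ a₂ i (k + d , r) ≡ closed a₁ a₂ i (k , r) [mod d ]
  closed-block-periodic a₁ a₂ i k d r = begin
    a₁ * ε r + a₂ * γ i (k + d , r)               ≡⟨ cong (λ g → a₁ * ε r + a₂ * g) (γ-block-shift i k d r) ⟩
    a₁ * ε r + a₂ * (γ i (k , r) + slope r * d)   ≡⟨ regroup a₁ a₂ (ε r) (γ i (k , r)) (slope r) d ⟩
    closed a₁ a₂ i (k , r) + a₂ * slope r * d     ≈⟨ +-multiple (closed a₁ a₂ i (k , r)) (a₂ * slope r) ⟩
    closed a₁ a₂ i (k , r)                        ∎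
    where
      open Congruence d
      open ≡-mod-Reasoning
      regroup : ∀ a₁ a₂ e g s d → a₁ * e + a₂ * (g + s * d) ≡ (a₁ * e + a₂ * g) + a₂ * s * d
      regroup = solve-∀

  closed-row-periodic : ∀ a₁ a₂ i k d r → closed a₁ a₂ (i + + 3 * d) (k - d , r) ≡ closed a₁ a₂ i (k , r) [mod d ]
  closed-row-periodic a₁ a₂ i k d zero             =
    ≡-mod-trans (≡⇒≡-mod (shift₀ a₁ a₂ i k d)) (+-multiple (closed a₁ a₂ i (k , zero)) a₂)
    where
      open Congruence d
      shift₀ : ∀ a₁ a₂ i k d → a₁ * + 1 + a₂ * - (k - d) ≡ (a₁ * + 1 + a₂ * - k) + a₂ * d
      shift₀ = solve-∀
  closed-row-periodic a₁ a₂ i k d (suc zero)       =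
    ≡-mod-trans (≡⇒≡-mod (shift₁ a₁ a₂ i k d)) (+-multiple (closed a₁ a₂ i (k , suc zero)) a₂)
    where
      open Congruence d
      shift₁ : ∀ a₁ a₂ i k d → a₁ * + 0 + a₂ * (+ 2 * (k - d) + + 1 + (i + + 3 * d))
                               ≡ (a₁ * + 0 + a₂ * (+ 2 * k + + 1 + i)) + a₂ * d
      shift₁ = solve-∀
  closed-row-periodic a₁ a₂ i k d (suc (suc zero)) =
    ≡-mod-trans (≡⇒≡-mod (shift₂ a₁ a₂ i k d)) (+-multiple (closed a₁ a₂ i (k , suc (suc zero))) (- + 2 * a₂))
    where
      open Congruence d
      shift₂ : ∀ a₁ a₂ i k d → a₁ * - + 1 + a₂ * - ((k - d) + + 1 + (i + + 3 * d))
                               ≡ (a₁ * - + 1 + a₂ * - (k + + 1 + i)) + - + 2 * a₂ * d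
      shift₂ = solve-∀

  γ-rotate : ∀ i t Λ M s → t ≡ i + offset s →
             γ (Λ * M * + 3 - (+ 1 + i + t)) (shift-block (next s) (i - Λ * M)) ≡ γ i s [mod M ]
  γ-rotate i t Λ M (k , zero) refl =
    ≡-mod-trans (≡⇒≡-mod (rotated₀ i k (Λ * M))) (+-multiple (γ i (k , zero)) Λ)
    where
      open Congruence M
      rotated₀ : ∀ i k L → + 2 * (k + (i - L)) + + 1 + (L * + 3 - (+ 1 + i + (i + (+ 0 + k * + 3)))) ≡ - k + L
      rotated₀ = solve-∀
  γ-rotate i t Λ M (k , suc zero) refl =
    ≡-mod-trans (≡⇒≡-mod (rotated₁ i k Λ M)) (+-multiple (γ i (k , suc zero)) (- + 2 * Λ))
    where
      open Congruence M
      rotated₁ : ∀ i k Λ M → - (k + (i - Λ * M) + + 1 + (Λ * M * + 3 - (+ 1 + i + (i + (+ 1 + k * + 3)))))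
                             ≡ (+ 2 * k + + 1 + i) + - + 2 * Λ * M
      rotated₁ = solve-∀
  γ-rotate i t Λ M (k , suc (suc zero)) refl =
    ≡-mod-trans (≡⇒≡-mod (rotated₂ i k (Λ * M))) (+-multiple (γ i (k , suc (suc zero))) Λ)
    where
      open Congruence M
      rotated₂ : ∀ i k L → - (k + + 1 + (i - L)) ≡ - (k + + 1 + i) + L
      rotated₂ = solve-∀

module Tuple24 where

  open import Data.Fin using (combine; opposite)
  open import Data.Integer using (+_; _+_; _*_; _≟_)
  open import Data.Fin.Properties using (all?)
  open import Data.Product using (_,_)
  open import Relation.Nullary.Decidable using (Dec; True; toWitness)
  open import Defs using (A₁; A₂)
  open ClosedForm using (ε; γ; slope)

  by-inspection : ∀ {m n} {P : Fin m → Fin n → Set} (P? : ∀ b r → Dec (P b r)) →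
                  {True (all? {P = λ b → ∀ r → P b r} λ b → all? (P? b))} → ∀ b r → P b r
  by-inspection P? {holds} = toWitness holds

  A₁-pattern : ∀ (b : Fin 8) (r : Fin 3) → A₁ (combine b r) ≡ ε r
  A₁-pattern = by-inspection λ b (r : Fin 3) → A₁ (combine b r) ≟ ε r

  A₁-mirror : ∀ (b : Fin 8) (r : Fin 3) → A₁ (combine b r) + A₁ (opposite (combine b r)) ≡ + 0
  A₁-mirror = by-inspection λ b (r : Fin 3) → A₁ (combine b r) + A₁ (opposite (combine b r)) ≟ + 0

  A₂-pattern : ∀ (b : Fin 8) (r : Fin 3) → A₂ (combine b r) ≡ γ (+ 0) (+ toℕ b , r)
  A₂-pattern = by-inspection λ b (r : Fin 3) → A₂ (combine b r) ≟ γ (+ 0) (+ toℕ b , r)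

  A₂-mirror : ∀ (b : Fin 8) (r : Fin 3) → A₂ (combine b r) + A₂ (opposite (combine b r)) ≡ + 8 * slope r
  A₂-mirror = by-inspection λ b (r : Fin 3) → A₂ (combine b r) + A₂ (opposite (combine b r)) ≟ + 8 * slope r

module MatrixX24 where

  open import Data.Fin using (opposite)
  open import Data.Nat using (zero; suc; _∸_)
  import Data.Nat.Properties as ℕP
  open import Data.Integer using (+_; _+_; _*_)
  import Data.Integer.Properties as ℤP
  open import Data.Integer.Tactic.RingSolver using (solve-∀)
  open import Data.Fin.Properties using (toℕ<n; opposite-prop)
  open import Function using (_∘_)
  open import Relation.Nullary using (Dec; yes; no; ¬_; contradiction)
  open import Relation.Binary.PropositionalEquality
  open import Defs using (δ; sumFin; X24)
  open ≡-Reasoning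

  δ-yes : ∀ {r s} → r ≡ s → δ r s ≡ + 1
  δ-yes {r} {s} r≡s with r ℕ.≟ s
  ... | yes _   = refl
  ... | no r≢s  = contradiction r≡s r≢s

  δ-no : ∀ {r s} → ¬ r ≡ s → δ r s ≡ + 0
  δ-no {r} {s} r≢s with r ℕ.≟ s
  ... | yes r≡s = contradiction r≡s r≢s
  ... | no _    = refl

  δ-suc : ∀ a b → δ (suc a) (suc b) ≡ δ a b
  δ-suc a b = by-cases (a ℕ.≟ b)
    where
      by-cases : Dec (a ≡ b) → δ (suc a) (suc b) ≡ δ a b
      by-cases (yes a≡b) = trans (δ-yes (cong suc a≡b)) (sym (δ-yes a≡b))
      by-cases (no a≢b)  = trans (δ-no (a≢b ∘ ℕP.suc-injective)) (sym (δ-no a≢b))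

  sumFin-cong : ∀ n {f g : Fin n → ℤ} → (∀ r → f r ≡ g r) → sumFin n f ≡ sumFin n g
  sumFin-cong zero    f≡g = refl
  sumFin-cong (suc n) f≡g = cong₂ _+_ (f≡g Fin.zero) (sumFin-cong n (f≡g ∘ Fin.suc))

  sumFin-+ : ∀ n (f g : Fin n → ℤ) → sumFin n (λ r → f r + g r) ≡ sumFin n f + sumFin n g
  sumFin-+ zero    f g = refl
  sumFin-+ (suc n) f g = trans (cong (_+_ (f Fin.zero + g Fin.zero)) (sumFin-+ n (f ∘ Fin.suc) (g ∘ Fin.suc)))
                               (exchange (f Fin.zero) (g Fin.zero) _ _)
    where
      exchange : ∀ a b c d → a + b + (c + d) ≡ a + c + (b + d)
      exchange = solve-∀

  sumFin-zero : ∀ n {f : Fin n → ℤ} → (∀ r → f r ≡ + 0) → sumFin n f ≡ + 0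
  sumFin-zero zero    f≡0 = refl
  sumFin-zero (suc n) f≡0 = cong₂ _+_ (f≡0 Fin.zero) (sumFin-zero n (f≡0 ∘ Fin.suc))

  sumFin-δ : ∀ n (x : Fin n → ℤ) (p : Fin n) → sumFin n (λ r → x r * δ (toℕ r) (toℕ p)) ≡ x p
  sumFin-δ (suc n) x Fin.zero = begin
    x Fin.zero * + 1 + sumFin n (λ r → x (Fin.suc r) * + 0)
      ≡⟨ cong (_+_ (x Fin.zero * + 1)) (sumFin-zero n (λ r → ℤP.*-zeroʳ (x (Fin.suc r)))) ⟩
    x Fin.zero * + 1 + + 0                                   ≡⟨ ℤP.+-identityʳ _ ⟩
    x Fin.zero * + 1                                         ≡⟨ ℤP.*-identityʳ _ ⟩
    x Fin.zero                                               ∎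
  sumFin-δ (suc n) x (Fin.suc p) = begin
    x Fin.zero * + 0 + sumFin n (λ r → x (Fin.suc r) * δ (suc (toℕ r)) (suc (toℕ p)))
      ≡⟨ cong₂ _+_ (ℤP.*-zeroʳ (x Fin.zero)) (sumFin-cong n (λ r → cong (x (Fin.suc r) *_) (δ-suc (toℕ r) (toℕ p)))) ⟩
    + 0 + sumFin n (λ r → x (Fin.suc r) * δ (toℕ r) (toℕ p))
      ≡⟨ ℤP.+-identityˡ _ ⟩
    sumFin n (λ r → x (Fin.suc r) * δ (toℕ r) (toℕ p))
      ≡⟨ sumFin-δ n (x ∘ Fin.suc) p ⟩
    x (Fin.suc p) ∎

  sumFin-X24 : ∀ (x : Fin 24 → ℤ) s → sumFin 24 (λ r → x r * X24 r s) ≡ x s + x (opposite s)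
  sumFin-X24 x s = begin
    sumFin 24 (λ r → x r * X24 r s)
      ≡⟨ sumFin-cong 24 (λ r → ℤP.*-distribˡ-+ (x r) (δ (suc (toℕ r)) (suc (toℕ s)))
                                                     (δ (suc (toℕ r)) (25 ∸ suc (toℕ s)))) ⟩
    sumFin 24 (λ r → x r * δ (suc (toℕ r)) (suc (toℕ s)) + x r * δ (suc (toℕ r)) (25 ∸ suc (toℕ s)))
      ≡⟨ sumFin-+ 24 (λ r → x r * δ (suc (toℕ r)) (suc (toℕ s))) (λ r → x r * δ (suc (toℕ r)) (25 ∸ suc (toℕ s))) ⟩
    sumFin 24 (λ r → x r * δ (suc (toℕ r)) (suc (toℕ s))) + sumFin 24 (λ r → x r * δ (suc (toℕ r)) (25 ∸ suc (toℕ s)))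
      ≡⟨ cong₂ _+_ (sumFin-cong 24 (λ r → cong (x r *_) (δ-suc (toℕ r) (toℕ s))))
                   (sumFin-cong 24 (λ r → cong (λ c → x r * δ (suc (toℕ r)) c) mirror)) ⟩
    sumFin 24 (λ r → x r * δ (toℕ r) (toℕ s)) + sumFin 24 (λ r → x r * δ (suc (toℕ r)) (suc (toℕ (opposite s))))
      ≡⟨ cong (_+_ (sumFin 24 (λ r → x r * δ (toℕ r) (toℕ s))))
              (sumFin-cong 24 (λ r → cong (x r *_) (δ-suc (toℕ r) (toℕ (opposite s))))) ⟩
    sumFin 24 (λ r → x r * δ (toℕ r) (toℕ s)) + sumFin 24 (λ r → x r * δ (toℕ r) (toℕ (opposite s)))
      ≡⟨ cong₂ _+_ (sumFin-δ 24 x s) (sumFin-δ 24 x (opposite s)) ⟩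
    x s + x (opposite s) ∎
    where
      mirror : 25 ∸ suc (toℕ s) ≡ suc (toℕ (opposite s))
      mirror = trans (ℕP.+-∸-assoc 1 (ℕ.s≤s⁻¹ (toℕ<n s))) (cong suc (sym (opposite-prop s)))

module OrbitOfS (m : ℕ) .{{_ : NonZero m}} (a₁ a₂ : ℤ) where

  open import Data.Fin using (fromℕ<; combine; opposite)
  open import Data.Fin.Properties using (combine-surjective; toℕ-combine; toℕ-fromℕ<)
  open import Data.Integer using (+_; -_; _+_; _-_; _*_; _/ℕ_; _%ℕ_)
  import Data.Integer.Properties as ℤP
  open import Data.Integer.DivMod using (n%ℕd<d; a≡a%ℕn+[a/ℕn]*n)
  open import Data.Integer.Tactic.RingSolver using (solve-∀)
  open import Data.Product using (_,_; proj₁; proj₂)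
  open import Relation.Binary.PropositionalEquality
  open import Defs
  open Modular
  open Congruence (+ m)
  open Reduction m
  open Slots
  open ClosedForm
  open Tuple24
  open MatrixX24

  A : Tuple 24 ℕ
  A = πT m (lincomb a₁ a₂)

  S : ℤ → ℕ
  S = IAP m 24 A (rowMul m A X24)

  lincomb-combine : ∀ (b : Fin 8) r → lincomb a₁ a₂ (combine b r) ≡ closed a₁ a₂ (+ 0) (+ toℕ b , r)
  lincomb-combine b r = cong₂ (λ x y → a₁ * x + a₂ * y) (A₁-pattern b r) (A₂-pattern b r)

  lincomb-mirror : ∀ (b : Fin 8) r →
                   lincomb a₁ a₂ (combine b r) + lincomb a₁ a₂ (opposite (combine b r)) ≡ a₂ * slope r * + 8
  lincomb-mirror b r = begin
    (a₁ * A₁ ρ + a₂ * A₂ ρ) + (a₁ * A₁ ρ′ + a₂ * A₂ ρ′)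
      ≡⟨ distribute a₁ a₂ (A₁ ρ) (A₁ ρ′) (A₂ ρ) (A₂ ρ′) ⟩
    a₁ * (A₁ ρ + A₁ ρ′) + a₂ * (A₂ ρ + A₂ ρ′)
      ≡⟨ cong₂ (λ x y → a₁ * x + a₂ * y) (A₁-mirror b r) (A₂-mirror b r) ⟩
    a₁ * + 0 + a₂ * (+ 8 * slope r)
      ≡⟨ simplify a₁ a₂ (slope r) ⟩
    a₂ * slope r * + 8 ∎
    where
      open ≡-Reasoning
      ρ = combine b r
      ρ′ = opposite (combine b r)
      distribute : ∀ a₁ a₂ x x′ y y′ →
                   (a₁ * x + a₂ * y) + (a₁ * x′ + a₂ * y′) ≡ a₁ * (x + x′) + a₂ * (y + y′)
      distribute = solve-∀
      simplify : ∀ a₁ a₂ s → a₁ * + 0 + a₂ * (+ 8 * s) ≡ a₂ * s * + 8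
      simplify = solve-∀

  rowMul-X24 : ∀ ρ → + rowMul m A X24 ρ ≡ lincomb a₁ a₂ ρ + lincomb a₁ a₂ (opposite ρ) [mod + m ]
  rowMul-X24 ρ = begin
    + rowMul m A X24 ρ                            ≈⟨ π-≡-mod (sumFin 24 (λ r → + A r * X24 r ρ)) ⟩
    sumFin 24 (λ r → + A r * X24 r ρ)             ≡⟨ sumFin-X24 (λ r → + A r) ρ ⟩
    + A ρ + + A (opposite ρ)
      ≈⟨ +-cong (π-≡-mod (lincomb a₁ a₂ ρ)) (π-≡-mod (lincomb a₁ a₂ (opposite ρ))) ⟩
    lincomb a₁ a₂ ρ + lincomb a₁ a₂ (opposite ρ)  ∎
    where open ≡-mod-Reasoning

  private
    S-closed-form-at : ∀ j b r → combine b r ≡ fromℕ< (n%ℕd<d j 24) → S j ≡ π m (closed a₁ a₂ (+ 0) (split j))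
    S-closed-form-at j b r combine-b-r≡ρ =
      trans (π-cong value) (cong (λ s → π m (closed a₁ a₂ (+ 0) s)) (offset-injective {k + q * + 8 , r} {split j} offsets-agree))
      where
        ρ = fromℕ< (n%ℕd<d j 24)
        q = j /ℕ 24
        L = lincomb a₁ a₂
        k = + toℕ b
        value : + A ρ + q * + rowMul m A X24 ρ ≡ closed a₁ a₂ (+ 0) (k + q * + 8 , r) [mod + m ]
        value = begin
          + A ρ + q * + rowMul m A X24 ρ
            ≈⟨ +-cong (π-≡-mod (L ρ)) (*-congˡ q (rowMul-X24 ρ)) ⟩
          L ρ + q * (L ρ + L (opposite ρ))
            ≡⟨ cong (λ c → L c + q * (L c + L (opposite c))) combine-b-r≡ρ ⟨
          L (combine b r) + q * (L (combine b r) + L (opposite (combine b r)))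
            ≡⟨ cong₂ (λ x y → x + q * y) (lincomb-combine b r) (lincomb-mirror b r) ⟩
          (a₁ * ε r + a₂ * γ (+ 0) (k , r)) + q * (a₂ * slope r * + 8)
            ≡⟨ regroup a₁ a₂ (ε r) (γ (+ 0) (k , r)) (slope r) q ⟩
          a₁ * ε r + a₂ * (γ (+ 0) (k , r) + slope r * (q * + 8))
            ≡⟨ cong (λ g → a₁ * ε r + a₂ * g) (γ-block-shift (+ 0) k (q * + 8) r) ⟨
          a₁ * ε r + a₂ * γ (+ 0) (k + q * + 8 , r) ∎
          where
            open ≡-mod-Reasoning
            regroup : ∀ a₁ a₂ e g s q → (a₁ * e + a₂ * g) + q * (a₂ * s * + 8) ≡ a₁ * e + a₂ * (g + s * (q * + 8))
            regroup = solve-∀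
        offsets-agree : offset (k + q * + 8 , r) ≡ offset (split j)
        offsets-agree = begin
          + toℕ r + (k + q * + 8) * + 3                ≡⟨ rearrange (+ toℕ r) k q ⟩
          (+ 3 * k + + toℕ r) + q * + 24               ≡⟨ cong (λ x → x + q * + 24) (sym (casts (toℕ b) (toℕ r))) ⟩
          + (3 ℕ.* toℕ b ℕ.+ toℕ r) + q * + 24         ≡⟨ cong (λ x → + x + q * + 24) (toℕ-combine b r) ⟨
          + toℕ (combine b r) + q * + 24               ≡⟨ cong (λ c → + toℕ c + q * + 24) combine-b-r≡ρ ⟩
          + toℕ ρ + q * + 24                           ≡⟨ cong (λ x → + x + q * + 24) (toℕ-fromℕ< (n%ℕd<d j 24)) ⟩
          + (j %ℕ 24) + q * + 24                       ≡⟨ a≡a%ℕn+[a/ℕn]*n j 24 ⟨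
          j                                            ≡⟨ offset-split j ⟨
          offset (split j)                             ∎
          where
            open ≡-Reasoning
            rearrange : ∀ r k q → r + (k + q * + 8) * + 3 ≡ (+ 3 * k + r) + q * + 24
            rearrange = solve-∀
            casts : ∀ b r → + (3 ℕ.* b ℕ.+ r) ≡ + 3 * + b + + r
            casts b r = trans (ℤP.pos-+ (3 ℕ.* b) r) (cong (_+ + r) (ℤP.pos-* 3 b))

  S-closed-form : ∀ j → S j ≡ π m (closed a₁ a₂ (+ 0) (split j))
  S-closed-form j = let b , r , combine-b-r≡ρ = combine-surjective (fromℕ< (n%ℕd<d j 24))
                    in S-closed-form-at j b r combine-b-r≡ρ

  orbit-closed-form : ∀ i j s → j ≡ + i + offset s → orbit m S i j ≡ π m (closed a₁ a₂ (+ i) s)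
  orbit-closed-form ℕ.zero j s j≡ =
    trans (S-closed-form j) (cong (λ s → π m (closed a₁ a₂ (+ 0) s)) (offset-injective {split j} {s} split-j≡s))
    where
      split-j≡s : offset (split j) ≡ offset s
      split-j≡s = trans (offset-split j) (trans j≡ (ℤP.+-identityˡ (offset s)))
  orbit-closed-form (ℕ.suc i) j s j≡ = π-cong (begin
    - + orbit m S i j - + orbit m S i (j + + 1)
      ≈⟨ +-cong (neg-cong (≡π⇒≡-mod (closed a₁ a₂ (+ i) (next s)) left))
                (neg-cong (≡π⇒≡-mod (closed a₁ a₂ (+ i) (next (next s))) right)) ⟩
    - closed a₁ a₂ (+ i) (next s) - closed a₁ a₂ (+ i) (next (next s))
      ≡⟨ closed-recurrence a₁ a₂ (+ i) s ⟩
    closed a₁ a₂ (+ ℕ.suc i) s ∎)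
    where
      open ≡-mod-Reasoning
      j≡′ : j ≡ + i + offset (next s)
      j≡′ = position-next-row {+ i} s j≡
      left : orbit m S i j ≡ π m (closed a₁ a₂ (+ i) (next s))
      left = orbit-closed-form i j (next s) j≡′
      right : orbit m S i (j + + 1) ≡ π m (closed a₁ a₂ (+ i) (next (next s)))
      right = orbit-closed-form i (j + + 1) (next (next s)) (position-suc {+ i} (next s) j≡′)

  orbit-periodic : PeriodicOrbit m S (3 ℕ.* m) (3 ℕ.* m)
  orbit-periodic i j = row-period , column-period
    where
      k = proj₁ (split (j - + i))
      r = proj₂ (split (j - + i))
      j≡ : j ≡ + i + offset (k , r)
      j≡ = position (+ i) j
      row-period : orbit m S (i ℕ.+ 3 ℕ.* m) j ≡ orbit m S i j
      row-period = begin
        orbit m S (i ℕ.+ 3 ℕ.* m) j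
          ≡⟨ orbit-closed-form (i ℕ.+ 3 ℕ.* m) j (k - + m , r) (trans (position-row-shift (+ i) k r (+ m) j≡)
                                                                      (cong (_+ offset (k - + m , r)) (sym casts))) ⟩
        π m (closed a₁ a₂ (+ (i ℕ.+ 3 ℕ.* m)) (k - + m , r))
          ≡⟨ cong (λ x → π m (closed a₁ a₂ x (k - + m , r))) casts ⟩
        π m (closed a₁ a₂ (+ i + + 3 * + m) (k - + m , r))
          ≡⟨ π-cong (closed-row-periodic a₁ a₂ (+ i) k (+ m) r) ⟩
        π m (closed a₁ a₂ (+ i) (k , r))
          ≡⟨ orbit-closed-form i j (k , r) j≡ ⟨
        orbit m S i j ∎
        where
          open ≡-Reasoning
          casts : + (i ℕ.+ 3 ℕ.* m) ≡ + i + + 3 * + m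
          casts = trans (ℤP.pos-+ i (3 ℕ.* m)) (cong (_+_ (+ i)) (ℤP.pos-* 3 m))
      column-period : orbit m S i (j + + (3 ℕ.* m)) ≡ orbit m S i j
      column-period = begin
        orbit m S i (j + + (3 ℕ.* m))
          ≡⟨ orbit-closed-form i (j + + (3 ℕ.* m)) (k + + m , r) (trans (cong (_+_ j) (ℤP.pos-* 3 m))
                                                                        (position-block-shift (+ i) k r (+ m) j≡)) ⟩
        π m (closed a₁ a₂ (+ i) (k + + m , r))
          ≡⟨ π-cong (closed-block-periodic a₁ a₂ (+ i) k (+ m) r) ⟩
        π m (closed a₁ a₂ (+ i) (k , r))
          ≡⟨ orbit-closed-form i j (k , r) j≡ ⟨
        orbit m S i j ∎
        where open ≡-Reasoning

module ResidueSums where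

  open import Data.Fin using (zero; suc)
  open import Data.Nat using (_+_; _*_)
  open import Data.Nat.Tactic.RingSolver using (solve-∀)
  open import Relation.Binary.PropositionalEquality
  open FiniteSums
  open TriangleSums

  ∑₃ : (Fin 3 → ℕ) → ℕ
  ∑₃ f = f zero + f (suc zero) + f (suc (suc zero))

  ∑₃-cong : ∀ {f g : Fin 3 → ℕ} → (∀ ρ → f ρ ≡ g ρ) → ∑₃ f ≡ ∑₃ g
  ∑₃-cong f≡g = cong₂ _+_ (cong₂ _+_ (f≡g zero) (f≡g (suc zero))) (f≡g (suc (suc zero)))

  ∑₃-select : ∀ r (f : Fin 3 → ℕ) → ∑₃ (λ ρ → 𝟙[ toℕ r ≡ toℕ ρ ] * f ρ) ≡ f r
  ∑₃-select zero             f = select₀ (f zero) (f (suc zero)) (f (suc (suc zero)))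
    where
      select₀ : ∀ a b c → 1 * a + 0 * b + 0 * c ≡ a
      select₀ = solve-∀
  ∑₃-select (suc zero)       f = select₁ (f zero) (f (suc zero)) (f (suc (suc zero)))
    where
      select₁ : ∀ a b c → 0 * a + 1 * b + 0 * c ≡ b
      select₁ = solve-∀
  ∑₃-select (suc (suc zero)) f = select₂ (f zero) (f (suc zero)) (f (suc (suc zero)))
    where
      select₂ : ∀ a b c → 0 * a + 0 * b + 1 * c ≡ c
      select₂ = solve-∀

  ∑₃-*ˡ : ∀ c (f : Fin 3 → ℕ) → ∑₃ (λ ρ → c * f ρ) ≡ c * ∑₃ f
  ∑₃-*ˡ c f = distribute c (f zero) (f (suc zero)) (f (suc (suc zero)))
    where
      distribute : ∀ c a b d → c * a + c * b + c * d ≡ c * (a + b + d)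
      distribute = solve-∀

  ∑-∑₃ : ∀ n (f : ℕ → Fin 3 → ℕ) → ∑[ g < n ] ∑₃ (f g) ≡ ∑₃ (λ ρ → ∑[ g < n ] f g ρ)
  ∑-∑₃ n f = trans (∑-+ n _ _) (cong (_+ ∑[ g < n ] f g (suc (suc zero))) (∑-+ n _ _))

  ∑△-∑₃ : ∀ N (f : ℕ → ℕ → Fin 3 → ℕ) →
          ∑△ N (λ i t → ∑₃ (f i t)) ≡ ∑₃ (λ ρ → ∑△ N (λ i t → f i t ρ))
  ∑△-∑₃ N f = trans (∑△-+ N _ _) (cong (_+ ∑△ N (λ i t → f i t (suc (suc zero)))) (∑△-+ N _ _))

module EntryCount (m : ℕ) .{{_ : NonZero m}} (a₁ a₂ : ℤ) where

  open import Data.Fin using (zero; suc)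
  open import Data.Fin.Properties using (toℕ-injective)
  import Data.Nat.Properties as ℕP
  open import Data.Integer using (+_; -_; _+_; _-_; _*_)
  import Data.Integer.Properties as ℤP
  open import Data.Integer.Tactic.RingSolver using (solve-∀)
  open import Data.Product using (_,_; proj₂; Σ-syntax)
  open import Function using (_∘_)
  open import Relation.Binary.PropositionalEquality
  open import Defs using (π; orbit)
  open Modular
  open Congruence (+ m)
  open Reduction m
  open IntegerCasts
  open FiniteSums
  open TriangleSums
  open ResidueSums
  open Slots
  open ClosedForm
  open OrbitOfS m a₁ a₂

  slot : ℕ → ℕ → Slot
  slot i t = split (+ t - + i)

  level : ℕ → ℕ → ℕ
  level i t = π m (γ (+ i) (slot i t))

  value : Fin 3 → ℕ → ℕ
  value ρ g = π m (a₁ * ε ρ + a₂ * + g)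

  entry-value : ∀ i t → orbit m S i (+ t) ≡ value (proj₂ (slot i t)) (level i t)
  entry-value i t = trans (orbit-closed-form i (+ t) (slot i t) (position (+ i) (+ t))) (π-cong (+-congˡ (a₁ * ε r) level≡))
    where
      r = proj₂ (slot i t)
      level≡ : a₂ * γ (+ i) (slot i t) ≡ a₂ * + level i t [mod + m ]
      level≡ = *-congˡ a₂ (≡-mod-sym (π-≡-mod (γ (+ i) (slot i t))))

  module Rotation (l : ℕ) where

    N : ℕ
    N = l ℕ.* (3 ℕ.* m)

    L : ℤ
    L = + l * + m

    rotated-row : ∀ i t → i ℕ.+ t ℕ.< N → + (N ℕ.∸ ℕ.suc (i ℕ.+ t)) ≡ L * + 3 - (+ 1 + + i + + t)
    rotated-row i t i+t<N = trans (pos-∸ i+t<N) (cong (_- (+ 1 + + i + + t)) casts)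
      where
        casts : + N ≡ L * + 3
        casts = trans (ℤP.pos-* l (3 ℕ.* m)) (trans (cong (+ l *_) (ℤP.pos-* 3 m)) (reorder (+ l) (+ m)))
          where
            reorder : ∀ l m → l * (+ 3 * m) ≡ l * m * + 3
            reorder = solve-∀

    rotated-slot : ∀ i t → i ℕ.+ t ℕ.< N → slot (N ℕ.∸ ℕ.suc (i ℕ.+ t)) i ≡ shift-block (next (slot i t)) (+ i - L)
    rotated-slot i t i+t<N = offset-injective {slot i′ i} {shift-block (next (slot i t)) (+ i - L)} (begin
      offset (slot i′ i)                                 ≡⟨ offset-split (+ i - + i′) ⟩
      + i - + i′                                         ≡⟨ cong (λ x → + i - x) (rotated-row i t i+t<N) ⟩
      + i - (L * + 3 - (+ 1 + + i + + t))
        ≡⟨ solve-for-offset {b = L * + 3 - (+ 1 + + i + + t)} (rotate-offset (+ i) (+ t) L (slot i t) (position (+ i) (+ t))) ⟩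
      offset (shift-block (next (slot i t)) (+ i - L))   ∎)
      where
        open ≡-Reasoning
        i′ = N ℕ.∸ ℕ.suc (i ℕ.+ t)
        solve-for-offset : ∀ {a b c} → a ≡ b + c → a - b ≡ c
        solve-for-offset {b = b} {c} refl = cancel b c
          where
            cancel : ∀ b c → (b + c) - b ≡ c
            cancel = solve-∀

    module _ {i t} (i+t<N : i ℕ.+ t ℕ.< N) where

      private
        i′ = N ℕ.∸ ℕ.suc (i ℕ.+ t)

      rotated-residue : proj₂ (slot i′ i) ≡ cycle (proj₂ (slot i t))
      rotated-residue = trans (cong proj₂ (rotated-slot i t i+t<N)) (residue-next (slot i t))

      rotated-level : level i′ i ≡ level i t
      rotated-level = begin
        π m (γ (+ i′) (slot i′ i))
          ≡⟨ cong₂ (λ r s → π m (γ r s)) (rotated-row i t i+t<N) (rotated-slot i t i+t<N) ⟩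
        π m (γ (L * + 3 - (+ 1 + + i + + t)) (shift-block (next (slot i t)) (+ i - L)))
          ≡⟨ π-cong (γ-rotate (+ i) (+ t) (+ l) (+ m) (slot i t) (position (+ i) (+ t))) ⟩
        π m (γ (+ i) (slot i t)) ∎
        where open ≡-Reasoning

    classSum : Fin 3 → (ℕ → ℕ) → ℕ
    classSum ρ h = ∑△ N (λ i t → 𝟙[ toℕ (proj₂ (slot i t)) ≡ toℕ ρ ] ℕ.* h (level i t))

    classSum-cycle : ∀ ρ h → classSum (cycle ρ) h ≡ classSum ρ h
    classSum-cycle ρ h = begin
      classSum (cycle ρ) h
        ≡⟨ ∑△-rotate N (λ i t → 𝟙[ toℕ (proj₂ (slot i t)) ≡ toℕ (cycle ρ) ] ℕ.* h (level i t)) ⟨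
      ∑△ N (λ i t → 𝟙[ toℕ (proj₂ (slot (rotated i t) i)) ≡ toℕ (cycle ρ) ] ℕ.* h (level (rotated i t) i))
        ≡⟨ ∑△-cong N (λ i t i+t<N → cong₂ (λ r g → 𝟙[ toℕ r ≡ toℕ (cycle ρ) ] ℕ.* h g)
                                          (rotated-residue i+t<N) (rotated-level i+t<N)) ⟩
      ∑△ N (λ i t → 𝟙[ toℕ (cycle (proj₂ (slot i t))) ≡ toℕ (cycle ρ) ] ℕ.* h (level i t))
        ≡⟨ ∑△-cong N (λ i t _ → cong (ℕ._* h (level i t)) (𝟙-cycle (proj₂ (slot i t)) ρ)) ⟩
      classSum ρ h ∎
      where
        open ≡-Reasoning
        rotated : ℕ → ℕ → ℕ
        rotated i t = N ℕ.∸ ℕ.suc (i ℕ.+ t)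
        𝟙-cycle : ∀ a b → 𝟙[ toℕ (cycle a) ≡ toℕ (cycle b) ] ≡ 𝟙[ toℕ a ≡ toℕ b ]
        𝟙-cycle a b = 𝟙-cong {toℕ (cycle a)} {toℕ (cycle b)} {toℕ a} {toℕ b}
                        (cong toℕ ∘ cycle-injective ∘ toℕ-injective) (cong (toℕ ∘ cycle) ∘ toℕ-injective)

    classSum-residue-0 : ∀ ρ h → classSum ρ h ≡ classSum zero h
    classSum-residue-0 zero             h = refl
    classSum-residue-0 (suc zero)       h = classSum-cycle zero h
    classSum-residue-0 (suc (suc zero)) h = trans (classSum-cycle (suc zero) h) (classSum-cycle zero h)

  Ψ : ℕ → ℕ → ℕ
  Ψ x g = ∑₃ (λ ρ → 𝟙[ x ≡ value ρ g ])

  φ : ℕ → Slot → ℕ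
  φ x (k , zero)  = Ψ x (π m (- k))
  φ x (k , suc _) = 0

  residue-0-as-φ : ∀ x i s → 𝟙[ toℕ (proj₂ s) ≡ 0 ] ℕ.* Ψ x (π m (γ (+ i) s)) ≡ φ x s
  residue-0-as-φ x i (k , zero)  = ℕP.+-identityʳ (Ψ x (π m (- k)))
  residue-0-as-φ x i (k , suc _) = refl

  φ-periodic : ∀ x s q → φ x (shift-block s (q * + m)) ≡ φ x s
  φ-periodic x (k , zero)  q = cong (Ψ x) (trans (cong (π m) (negate k q (+ m))) (π-+-multiple (- k) (- q)))
    where
      negate : ∀ k q m → - (k + q * m) ≡ - k + - q * m
      negate = solve-∀
  φ-periodic x (k , suc _) q = refl

  split-pos : ∀ g r → split (+ (toℕ r ℕ.+ g ℕ.* 3)) ≡ (+ g , r)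
  split-pos g r = offset-injective {split (+ (toℕ r ℕ.+ g ℕ.* 3))} {+ g , r}
    (trans (offset-split _) (trans (ℤP.pos-+ (toℕ r) (g ℕ.* 3)) (cong (_+_ (+ toℕ r)) (ℤP.pos-* g 3))))

  ∑-φ : ∀ x → ∑[ h < 3 ℕ.* m ] φ x (split (+ h)) ≡ ∑[ g < m ] Ψ x (π m (- + g))
  ∑-φ x = trans (∑-by-residue-3 m (λ h → φ x (split (+ h))))
                (∑-cong m (λ g _ → trans (cong₂ ℕ._+_ (cong (φ x) (split-pos g zero))
                                                      (cong₂ ℕ._+_ (cong (φ x) (split-pos g (suc zero)))
                                                                   (cong (φ x) (split-pos g (suc (suc zero))))))
                                         (ℕP.+-identityʳ _)))

  module _ (l w : ℕ) (3m≡1+2w : 3 ℕ.* m ≡ ℕ.suc (2 ℕ.* w)) where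

    private
      instance
        3m≢0 : NonZero (3 ℕ.* m)
        3m≢0 = ℕP.m*n≢0 3 m

    open Rotation l
    open TriangleDifferences (3 ℕ.* m) w 3m≡1+2w

    private
      casts : + (3 ℕ.* m) ≡ + m * + 3
      casts = trans (ℤP.pos-* 3 m) (ℤP.*-comm (+ 3) (+ m))

      φ-mod-3m : ∀ x i t → φ x (slot i t) ≡ φ x (split (+ π (3 ℕ.* m) (+ t - + i)))
      φ-mod-3m x i t = shifted (split-mod (+ m) (subst (d ≡ d′ [mod_]) casts d≡d′))
        where
          d = + t - + i
          d′ = + π (3 ℕ.* m) d
          d≡d′ : d ≡ d′ [mod + (3 ℕ.* m) ]
          d≡d′ = Congruence.≡-mod-sym (+ (3 ℕ.* m)) (Reduction.π-≡-mod (3 ℕ.* m) d)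
          shifted : Σ[ q ∈ ℤ ] split d ≡ shift-block (split d′) (q * + m) → φ x (split d) ≡ φ x (split d′)
          shifted (q , split-d≡) = trans (cong (φ x) split-d≡) (φ-periodic x (split d′) q)

    count-entries : ∀ x → ∑△ N (λ i t → 𝟙[ x ≡ orbit m S i (+ t) ])
                          ≡ differences N 0 ℕ.* ∑[ g < m ] Ψ x (π m (- + g))
    count-entries x = begin
      ∑△ N (λ i t → 𝟙[ x ≡ orbit m S i (+ t) ])
        ≡⟨ ∑△-cong N (λ i t _ → trans (cong 𝟙[ x ≡_] (entry-value i t))
                                      (sym (∑₃-select (residue i t) (λ ρ → 𝟙[ x ≡ value ρ (level i t) ])))) ⟩
      ∑△ N (λ i t → ∑₃ (λ ρ → 𝟙[ toℕ (residue i t) ≡ toℕ ρ ] ℕ.* 𝟙[ x ≡ value ρ (level i t) ]))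
        ≡⟨ ∑△-∑₃ N (λ i t ρ → 𝟙[ toℕ (residue i t) ≡ toℕ ρ ] ℕ.* 𝟙[ x ≡ value ρ (level i t) ]) ⟩
      ∑₃ (λ ρ → classSum ρ (λ g → 𝟙[ x ≡ value ρ g ]))
        ≡⟨ ∑₃-cong (λ ρ → classSum-residue-0 ρ (λ g → 𝟙[ x ≡ value ρ g ])) ⟩
      ∑₃ (λ ρ → classSum zero (λ g → 𝟙[ x ≡ value ρ g ]))
        ≡⟨ ∑△-∑₃ N (λ i t ρ → 𝟙[ toℕ (residue i t) ≡ 0 ] ℕ.* 𝟙[ x ≡ value ρ (level i t) ]) ⟨
      ∑△ N (λ i t → ∑₃ (λ ρ → 𝟙[ toℕ (residue i t) ≡ 0 ] ℕ.* 𝟙[ x ≡ value ρ (level i t) ]))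
        ≡⟨ ∑△-cong N (λ i t _ → trans (∑₃-*ˡ 𝟙[ toℕ (residue i t) ≡ 0 ] (λ ρ → 𝟙[ x ≡ value ρ (level i t) ]))
                                      (residue-0-as-φ x i (slot i t))) ⟩
      ∑△ N (λ i t → φ x (slot i t))
        ≡⟨ ∑△-cong N (λ i t _ → φ-mod-3m x i t) ⟩
      ∑△ N (λ i t → φ x (split (+ π (3 ℕ.* m) (+ t - + i))))
        ≡⟨ ∑△-by-difference l (λ h → φ x (split (+ h))) ⟩
      differences N 0 ℕ.* ∑[ h < 3 ℕ.* m ] φ x (split (+ h))
        ≡⟨ cong (differences N 0 ℕ.*_) (∑-φ x) ⟩
      differences N 0 ℕ.* ∑[ g < m ] Ψ x (π m (- + g)) ∎
      where
        open ≡-Reasoning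
        residue : ℕ → ℕ → Fin 3
        residue i t = proj₂ (slot i t)

module Units where

  open import Data.Nat using (suc; _^_)
  open import Data.Integer using (+_; -_; _+_; _-_; _*_)
  import Data.Integer.Properties as ℤP
  open import Data.Integer.Tactic.RingSolver using (solve-∀)
  open import Relation.Binary.PropositionalEquality
  open Modular

  module _ {k : ℤ} where

    open Congruence k

    unit-* : ∀ {a b} → IsUnit k a → IsUnit k b → IsUnit k (a * b)
    unit-* {a} {b} (unit a⁻¹ aa⁻¹≡1) (unit b⁻¹ bb⁻¹≡1) = unit (b⁻¹ * a⁻¹) (begin
      a * b * (b⁻¹ * a⁻¹)     ≡⟨ regroup a b a⁻¹ b⁻¹ ⟩
      (a * a⁻¹) * (b * b⁻¹)   ≈⟨ *-cong aa⁻¹≡1 bb⁻¹≡1 ⟩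
      + 1 * + 1               ∎)
      where
        open ≡-mod-Reasoning
        regroup : ∀ a b a⁻¹ b⁻¹ → a * b * (b⁻¹ * a⁻¹) ≡ (a * a⁻¹) * (b * b⁻¹)
        regroup = solve-∀

    unit-neg : ∀ {a} → IsUnit k a → IsUnit k (- a)
    unit-neg {a} (unit a⁻¹ aa⁻¹≡1) = unit (- a⁻¹) (≡-mod-trans (≡⇒≡-mod (neg-neg a a⁻¹)) aa⁻¹≡1)
      where
        neg-neg : ∀ a b → - a * - b ≡ a * b
        neg-neg = solve-∀

    unit-^ : ∀ {a} → IsUnit k (+ a) → ∀ n → IsUnit k (+ (a ^ n))
    unit-^ a-unit ℕ.zero    = unit (+ 1) ≡-mod-refl
    unit-^ {a} a-unit (suc n) = subst (IsUnit k) (sym (ℤP.pos-* a (a ^ n))) (unit-* a-unit (unit-^ a-unit n))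

module ResidueCounts (m : ℕ) .{{_ : NonZero m}} where

  open import Data.Integer using (+_; _+_; _*_)
  open import Relation.Binary.PropositionalEquality
  open import Defs using (π)
  open Modular
  open FiniteSums
  open ResidueSums
  open ClosedForm using (ε)
  open AffineCount m

  residueCount : ℤ → ℤ → ℕ → ℕ
  residueCount a₁ a x = ∑₃ (λ ρ → ∑[ g < m ] 𝟙[ x ≡ π m (a₁ * ε ρ + a * + g) ])

  residueCount-unit : ∀ a₁ {a x} → IsUnit (+ m) a → x ℕ.< m → residueCount a₁ a x ≡ 3
  residueCount-unit a₁ {a} a-unit x<m = ∑₃-cong (λ ρ → ∑-𝟙-affine a (a₁ * ε ρ) a-unit x<m)

module TripleResidueCounts (m′ : ℕ) .{{_ : NonZero m′}} where

  open import Data.Nat using (_*_; _%_; _/_; zero; suc; s≤s)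
  import Data.Nat.Properties as ℕP
  import Data.Nat.DivMod as ℕD
  open import Data.Integer using (+_; -_; _+_; _-_; _/ℕ_) renaming (_*_ to _⊛_)
  open import Data.Integer.DivMod using (a≡a%ℕn+[a/ℕn]*n)
  import Data.Integer.Properties as ℤP
  open import Data.Integer.Divisibility.Signed using (_∣_; divides)
  open import Data.Integer.Tactic.RingSolver using (solve-∀)
  open import Relation.Nullary using (contradiction)
  open import Relation.Binary.PropositionalEquality
  open import Defs using (π)
  open Modular
  open FiniteSums
  open ResidueSums
  open ClosedForm using (ε)

  M : ℕ
  M = 3 * m′

  instance
    M≢0 : NonZero M
    M≢0 = ℕP.m*n≢0 3 m′

  open Reduction M
  module Mod3 = Reduction 3

  3∣M : + 3 ∣ + M
  3∣M = divides (+ m′) (trans (ℤP.pos-* 3 m′) (ℤP.*-comm (+ 3) (+ m′)))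

  π-triple : ∀ y → π M (y ⊛ + 3) ≡ π m′ y * 3
  π-triple y = begin
    π M (y ⊛ + 3)
      ≡⟨ cong (λ z → π M (z ⊛ + 3)) (a≡a%ℕn+[a/ℕn]*n y m′) ⟩
    π M ((+ π m′ y + y /ℕ m′ ⊛ + m′) ⊛ + 3)
      ≡⟨ cong (π M) (regroup (+ π m′ y) (y /ℕ m′) (+ m′)) ⟩
    π M (+ π m′ y ⊛ + 3 + y /ℕ m′ ⊛ (+ 3 ⊛ + m′))
      ≡⟨ cong₂ (λ a b → π M (a + y /ℕ m′ ⊛ b)) (ℤP.pos-* (π m′ y) 3) (ℤP.pos-* 3 m′) ⟨
    π M (+ (π m′ y * 3) + y /ℕ m′ ⊛ + M)
      ≡⟨ π-+-multiple (+ (π m′ y * 3)) (y /ℕ m′) ⟩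
    π M (+ (π m′ y * 3))
      ≡⟨ π-small (subst (π m′ y * 3 ℕ.<_) (ℕP.*-comm m′ 3) (ℕP.*-monoˡ-< 3 (Reduction.π< m′ y))) ⟩
    π m′ y * 3 ∎
    where
      open ≡-Reasoning
      regroup : ∀ r q n → (r + q ⊛ n) ⊛ + 3 ≡ r ⊛ + 3 + q ⊛ (+ 3 ⊛ n)
      regroup = solve-∀

  ∑-𝟙-triples : ∀ {z} → z ℕ.< M → ∑[ g < m′ ] 𝟙[ z ≡ g * 3 ] ≡ 𝟙[ z % 3 ≡ 0 ]
  ∑-𝟙-triples {z} z<M with z % 3 in z%3≡
  ... | zero = begin
    ∑[ g < m′ ] 𝟙[ z ≡ g * 3 ]  ≡⟨ ∑-cong m′ (λ g _ → 𝟙-cong {z} {g * 3} {z / 3} {g} (to g) (from g)) ⟩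
    ∑[ g < m′ ] 𝟙[ z / 3 ≡ g ]  ≡⟨ ∑-𝟙 m′ z/3<m′ ⟩
    1                           ∎
    where
      open ≡-Reasoning
      z≡[z/3]*3 : z ≡ z / 3 * 3
      z≡[z/3]*3 = trans (ℕD.m≡m%n+[m/n]*n z 3) (cong (ℕ._+ z / 3 * 3) z%3≡)
      to : ∀ g → z ≡ g * 3 → z / 3 ≡ g
      to g z≡g*3 = ℕP.*-cancelʳ-≡ (z / 3) g 3 (trans (sym z≡[z/3]*3) z≡g*3)
      z/3<m′ : z / 3 ℕ.< m′
      z/3<m′ = ℕP.*-cancelʳ-< 3 (z / 3) m′ (subst₂ ℕ._<_ z≡[z/3]*3 (ℕP.*-comm 3 m′) z<M)
      from : ∀ g → z / 3 ≡ g → z ≡ g * 3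
      from g z/3≡g = trans z≡[z/3]*3 (cong (_* 3) z/3≡g)
  ... | suc _ = ∑-zero m′ (λ g _ → 𝟙-no {z} {g * 3} λ z≡g*3 →
                  ℕP.1+n≢0 (trans (sym z%3≡) (trans (cong (_% 3) z≡g*3) (ℕD.m*n%n≡0 g 3))))

  private
    divisible-by-3 : ∀ a′ b x c → a′ ⊛ b ≡ + 1 [mod + M ] → π M (b ⊛ (+ x - c)) % 3 ≡ 0 → π 3 (+ x) ≡ π 3 c
    divisible-by-3 a′ b x c a′b≡1 z%3≡0 =
      Mod3.π-cong {+ x} {c} (x-y≡0⇒≡-mod (unit-cancelˡ {a′} {b} (≡-mod-∣ 3∣M a′b≡1) (begin
      b ⊛ (+ x - c)               ≈⟨ ≡-mod-∣ 3∣M (π-≡-mod (b ⊛ (+ x - c))) ⟨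
      + π M (b ⊛ (+ x - c))       ≈⟨ Mod3.π≡0⇒≡-mod-0 {+ π M (b ⊛ (+ x - c))} z%3≡0 ⟩
      + 0                         ≡⟨ ℤP.*-zeroʳ b ⟨
      b ⊛ + 0                     ∎)))
      where
        open Congruence (+ 3)
        open ≡-mod-Reasoning

    divisible-by-3⁻¹ : ∀ b x c → π 3 (+ x) ≡ π 3 c → π M (b ⊛ (+ x - c)) % 3 ≡ 0
    divisible-by-3⁻¹ b x c x≡c = Mod3.≡-mod-0⇒π≡0 (begin
      + π M (b ⊛ (+ x - c))       ≈⟨ ≡-mod-∣ 3∣M (π-≡-mod (b ⊛ (+ x - c))) ⟩
      b ⊛ (+ x - c)               ≈⟨ *-congˡ b (≡-mod⇒x-y≡0 (Mod3.π-injective {+ x} {c} x≡c)) ⟩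
      b ⊛ + 0                     ≡⟨ ℤP.*-zeroʳ b ⟩
      + 0                         ∎)
      where
        open Congruence (+ 3)
        open ≡-mod-Reasoning

    π-periodic : ∀ g → π m′ (+ (m′ ℕ.+ g)) ≡ π m′ (+ g)
    π-periodic g = trans (cong (π m′) (shift (ℤP.pos-+ m′ g))) (Reduction.π-+-multiple m′ (+ g) (+ 1))
      where
        rearrange : ∀ g m → m + g ≡ g + + 1 ⊛ m
        rearrange = solve-∀
        shift : + (m′ ℕ.+ g) ≡ + m′ + + g → + (m′ ℕ.+ g) ≡ + g + + 1 ⊛ + m′
        shift eq = trans eq (rearrange (+ g) (+ m′))

  -- Multiplying by the inverse of a′, the congruence c + 3a′g ≡ x (mod 3m′) becomes 3g ≡ z (mod 3m′)
  -- for z = a′⁻¹(x − c); it has three solutions g < 3m′ when 3 ∣ z, i.e. when x ≡ c (mod 3), and none otherwise.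
  ∑-𝟙-affine-triple : ∀ a′ c {x} → IsUnit (+ M) a′ → x ℕ.< M →
                      ∑[ g < M ] 𝟙[ x ≡ π M (c + + 3 ⊛ a′ ⊛ + g) ] ≡ 3 * 𝟙[ π 3 (+ x) ≡ π 3 c ]
  ∑-𝟙-affine-triple a′ c {x} (unit b a′b≡1) x<M = begin
    ∑[ g < M ] 𝟙[ x ≡ π M (c + + 3 ⊛ a′ ⊛ + g) ]
      ≡⟨ ∑-cong M (λ g _ → trans (cong (λ y → 𝟙[ x ≡ π M y ]) (regroup c a′ (+ g)))
                                 (AffineCount.𝟙-affine-solve M a′ c (unit b a′b≡1) x<M (+ g ⊛ + 3))) ⟩
    ∑[ g < M ] 𝟙[ z ≡ π M (+ g ⊛ + 3) ]
      ≡⟨ ∑-cong M (λ g _ → cong 𝟙[ z ≡_] (π-triple (+ g))) ⟩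
    ∑[ g < M ] 𝟙[ z ≡ π m′ (+ g) * 3 ]
      ≡⟨ ∑-periodic m′ (λ g → 𝟙[ z ≡ π m′ (+ g) * 3 ]) (λ g → cong (λ r → 𝟙[ z ≡ r * 3 ]) (π-periodic g)) 3 ⟩
    3 * ∑[ g < m′ ] 𝟙[ z ≡ π m′ (+ g) * 3 ]
      ≡⟨ cong (3 *_) (∑-cong m′ (λ g g<m′ → cong (λ r → 𝟙[ z ≡ r * 3 ]) (Reduction.π-small m′ g<m′))) ⟩
    3 * ∑[ g < m′ ] 𝟙[ z ≡ g * 3 ]
      ≡⟨ cong (3 *_) (∑-𝟙-triples (π< (b ⊛ (+ x - c)))) ⟩
    3 * 𝟙[ z % 3 ≡ 0 ]
      ≡⟨ cong (3 *_) (𝟙-cong {z % 3} {0} {π 3 (+ x)} {π 3 c} (divisible-by-3 a′ b x c a′b≡1) (divisible-by-3⁻¹ b x c)) ⟩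
    3 * 𝟙[ π 3 (+ x) ≡ π 3 c ] ∎
    where
      open ≡-Reasoning
      z = π M (b ⊛ (+ x - c))
      regroup : ∀ c a′ g → c + + 3 ⊛ a′ ⊛ g ≡ c + a′ ⊛ (g ⊛ + 3)
      regroup = solve-∀

  private
    -- For 3 ∤ a₁ the values a₁ε(ρ) = a₁, 0, −a₁ form a complete residue system modulo 3.
    one-residue-matches : ∀ {u y} → u ≢ 0 → u ℕ.< 3 → y ℕ.< 3 → ∑₃ (λ ρ → 𝟙[ y ≡ π 3 (+ u ⊛ ε ρ) ]) ≡ 1
    one-residue-matches {1} {0} _ _ _ = refl
    one-residue-matches {1} {1} _ _ _ = refl
    one-residue-matches {1} {2} _ _ _ = refl
    one-residue-matches {2} {0} _ _ _ = refl
    one-residue-matches {2} {1} _ _ _ = refl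
    one-residue-matches {2} {2} _ _ _ = refl
    one-residue-matches {0} u≢0 _ _ = contradiction refl u≢0
    one-residue-matches {suc (suc (suc _))} _ (s≤s (s≤s (s≤s ()))) _
    one-residue-matches {suc _} {suc (suc (suc _))} _ _ (s≤s (s≤s (s≤s ())))

  residueCount-triple : ∀ a₁ {a′ x} → IsUnit (+ M) a′ → π 3 a₁ ≢ 0 → x ℕ.< M →
                        ResidueCounts.residueCount M a₁ (+ 3 ⊛ a′) x ≡ 3
  residueCount-triple a₁ {a′} {x} a′-unit a₁≢0 x<M = begin
    ∑₃ (λ ρ → ∑[ g < M ] 𝟙[ x ≡ π M (a₁ ⊛ ε ρ + + 3 ⊛ a′ ⊛ + g) ])
      ≡⟨ ∑₃-cong (λ ρ → ∑-𝟙-affine-triple a′ (a₁ ⊛ ε ρ) a′-unit x<M) ⟩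
    ∑₃ (λ ρ → 3 * 𝟙[ π 3 (+ x) ≡ π 3 (a₁ ⊛ ε ρ) ])
      ≡⟨ ∑₃-*ˡ 3 (λ ρ → 𝟙[ π 3 (+ x) ≡ π 3 (a₁ ⊛ ε ρ) ]) ⟩
    3 * ∑₃ (λ ρ → 𝟙[ π 3 (+ x) ≡ π 3 (a₁ ⊛ ε ρ) ])
      ≡⟨ cong (3 *_) (∑₃-cong (λ ρ → cong 𝟙[ π 3 (+ x) ≡_] (Mod3.π-cong (*-congʳ (ε ρ) (≡-mod-sym (Mod3.π-≡-mod a₁)))))) ⟩
    3 * ∑₃ (λ ρ → 𝟙[ π 3 (+ x) ≡ π 3 (+ π 3 a₁ ⊛ ε ρ) ])
      ≡⟨ cong (3 *_) (one-residue-matches a₁≢0 (Mod3.π< a₁) (Mod3.π< (+ x))) ⟩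
    3 ∎
    where
      open ≡-Reasoning
      open Congruence (+ 3)

module OddModulus (m : ℕ) .{{_ : NonZero m}} where

  open import Data.Nat using (suc; _*_; _%_; _/_; s≤s)
  import Data.Nat.Properties as ℕP
  import Data.Nat.DivMod as ℕD
  open import Data.Nat.Divisibility using (_∣_; m%n≡0⇒n∣m)
  open import Data.Integer using (+_; -_; _+_; _-_) renaming (_*_ to _⊛_)
  import Data.Integer.Properties as ℤP
  open import Data.Integer.Divisibility.Signed using (divides)
  open import Data.Integer.Tactic.RingSolver using (solve-∀)
  import Data.Nat.Tactic.RingSolver as ℕ-Solver
  open import Data.Product using (Σ-syntax; _,_)
  open import Relation.Nullary using (¬_; contradiction)
  open import Relation.Binary.PropositionalEquality
  open Modular

  odd⇒1+2q : ¬ 2 ∣ m → Σ[ q ∈ ℕ ] m ≡ suc (2 * q)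
  odd⇒1+2q 2∤m with m % 2 in m%2≡ | ℕD.m%n<n m 2
  ... | 0     | _ = contradiction (m%n≡0⇒n∣m m 2 m%2≡) 2∤m
  ... | 1     | _ = m / 2 , trans (ℕD.m≡m%n+[m/n]*n m 2)
                                    (trans (cong (λ r → r ℕ.+ m / 2 * 2) m%2≡) (cong suc (ℕP.*-comm (m / 2) 2)))
  ... | suc (suc _) | s≤s (s≤s ())

  3m-odd : ¬ 2 ∣ m → Σ[ w ∈ ℕ ] 3 * m ≡ suc (2 * w)
  3m-odd 2∤m = let q , m≡1+2q = odd⇒1+2q 2∤m in suc (3 * q) , trans (cong (3 *_) m≡1+2q) (expand q)
    where
      expand : ∀ q → 3 * suc (2 * q) ≡ suc (2 * suc (3 * q))
      expand = ℕ-Solver.solve-∀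

  private
    cast : ∀ r q k → m ≡ r ℕ.+ q * k → + m ≡ + r + + q ⊛ + k
    cast r q k m≡ = trans (cong +_ m≡) (trans (ℤP.pos-+ r (q * k)) (cong (_+_ (+ r)) (ℤP.pos-* q k)))

  two-unit : Σ[ q ∈ ℕ ] m ≡ suc (2 * q) → IsUnit (+ m) (+ 2)
  two-unit (q , m≡) = unit (+ suc q) (≡-mod (divides (+ 1) (trans (inverse (+ q)) (cong (_⊛_ (+ 1)) (sym (cast 1 2 q m≡))))))
    where
      inverse : ∀ q → + 2 ⊛ (+ 1 + q) - + 1 ≡ + 1 ⊛ (+ 1 + + 2 ⊛ q)
      inverse = solve-∀

  three-unit : ¬ 3 ∣ m → IsUnit (+ m) (+ 3)
  three-unit 3∤m with m % 3 in m%3≡ | ℕD.m%n<n m 3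
  ... | 0 | _ = contradiction (m%n≡0⇒n∣m m 3 m%3≡) 3∤m
  ... | 1 | _ = unit (- + q) (≡-mod (divides (- + 1) (trans (inverse₁ (+ q)) (cong (_⊛_ (- + 1)) (sym (cast 1 q 3 m≡))))))
    where
      q = m / 3
      m≡ : m ≡ 1 ℕ.+ q * 3
      m≡ = trans (ℕD.m≡m%n+[m/n]*n m 3) (cong (ℕ._+ q * 3) m%3≡)
      inverse₁ : ∀ q → + 3 ⊛ - q - + 1 ≡ - + 1 ⊛ (+ 1 + q ⊛ + 3)
      inverse₁ = solve-∀
  ... | 2 | _ = unit (+ suc q) (≡-mod (divides (+ 1) (trans (inverse₂ (+ q)) (cong (_⊛_ (+ 1)) (sym (cast 2 q 3 m≡))))))
    where
      q = m / 3
      m≡ : m ≡ 2 ℕ.+ q * 3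
      m≡ = trans (ℕD.m≡m%n+[m/n]*n m 3) (cong (ℕ._+ q * 3) m%3≡)
      inverse₂ : ∀ q → + 3 ⊛ (+ 1 + q) - + 1 ≡ + 1 ⊛ (+ 2 + q ⊛ + 3)
      inverse₂ = solve-∀
  ... | suc (suc (suc _)) | s≤s (s≤s (s≤s ()))

module CoefficientsInO where

  open import Data.Bool using (true; false)
  open import Data.Nat using (zero; suc; _*_; _^_; _≤_; s≤s)
  import Data.Nat.Properties as ℕP
  open import Data.Nat.Divisibility as ℕDiv using (_∣?_) renaming (_∣_ to _∣ℕ_)
  open import Data.Integer using (+_; -_; _+_; _-_; ∣_∣) renaming (_*_ to _⊛_)
  import Data.Integer.Properties as ℤP
  open import Data.Integer.Divisibility using () renaming (_∣_ to _∣ᵤ_)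
  open import Data.Integer.Divisibility.Signed using (_∣_; ∣⇒∣ᵤ)
  open import Data.Integer.GCD using (gcd; gcd-greatest)
  open import Relation.Nullary using (¬_; yes; no)
  open import Relation.Binary.PropositionalEquality
  open import Defs using (π; signed)
  open Modular
  open Units
  open ResidueCounts

  signed-unit : ∀ {k a} s → IsUnit k a → IsUnit k (signed s a)
  signed-unit true  a-unit = a-unit
  signed-unit false a-unit = unit-neg a-unit

  neg-signed-triple : ∀ s n → - signed s (+ (3 * n)) ≡ + 3 ⊛ - signed s (+ n)
  neg-signed-triple true  n = trans (cong -_ (ℤP.pos-* 3 n)) (ℤP.neg-distribʳ-* (+ 3) (+ n))
  neg-signed-triple false n =
    trans (ℤP.neg-involutive (+ (3 * n))) (trans (ℤP.pos-* 3 n) (cong (_⊛_ (+ 3)) (sym (ℤP.neg-involutive (+ n)))))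

  π₃≢0 : ∀ a₁ s n → ¬ (+ 3 ∣ᵤ gcd a₁ (signed s (+ (3 * n)))) → π 3 a₁ ≢ 0
  π₃≢0 a₁ s n 3∤gcd π₃a₁≡0 = 3∤gcd (gcd-greatest {a₁} {signed s (+ (3 * n))} {+ 3} 3∣a₁ 3∣a₂)
    where
      3∣a₁ : + 3 ∣ᵤ a₁
      3∣a₁ = ∣⇒∣ᵤ (subst (+ 3 ∣_) (ℤP.+-identityʳ a₁)
                         (_≡_[mod_].∣-difference (Reduction.π≡0⇒≡-mod-0 3 {a₁} π₃a₁≡0)))
      3∣a₂ : + 3 ∣ᵤ signed s (+ (3 * n))
      3∣a₂ = ℕDiv.divides n (trans (abs-signed s) (ℕP.*-comm 3 n))
        where
          abs-signed : ∀ s → ∣ signed s (+ (3 * n)) ∣ ≡ 3 * n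
          abs-signed true  = refl
          abs-signed false = ℤP.∣-i∣≡∣i∣ (+ (3 * n))

  private
    2^β-unit : ∀ m .{{_ : NonZero m}} → ¬ 2 ∣ℕ m → ∀ β → IsUnit (+ m) (+ (2 ^ β))
    2^β-unit m 2∤m = unit-^ (OddModulus.two-unit m (OddModulus.odd⇒1+2q m 2∤m))

    neg-signed-unit : ∀ {k n} s → IsUnit k (+ n) → IsUnit k (- signed s (+ n))
    neg-signed-unit s n-unit = unit-neg (signed-unit s n-unit)

    triple-case : ∀ a₁ s β m q .{{_ : NonZero m}} → m ≡ 3 * q → ¬ 2 ∣ℕ m → π 3 a₁ ≢ 0 →
                  ∀ {x} → x ℕ.< m → residueCount m a₁ (- signed s (+ (3 * 2 ^ β))) x ≡ 3
    triple-case a₁ s β .(3 * q) q refl 2∤m π₃a₁≢0 {x} =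
      subst (λ a → x ℕ.< 3 * q → residueCount (3 * q) a₁ a x ≡ 3) (sym (neg-signed-triple s (2 ^ β)))
        (TripleResidueCounts.residueCount-triple q {{ℕP.m*n≢0⇒n≢0 3}} a₁
          (neg-signed-unit s (2^β-unit (3 * q) 2∤m β)) π₃a₁≢0)

  residueCount≡3 : ∀ a₁ s α β → α ≤ 1 → ¬ (+ 3 ∣ᵤ gcd a₁ (signed s (+ (3 ^ α * 2 ^ β)))) →
                   ∀ m .{{_ : NonZero m}} → ¬ 2 ∣ℕ m →
                   ∀ {x} → x ℕ.< m → residueCount m a₁ (- signed s (+ (3 ^ α * 2 ^ β))) x ≡ 3
  residueCount≡3 a₁ s zero β _ _ m 2∤m =
    residueCount-unit m a₁ (neg-signed-unit s (subst (λ n → IsUnit (+ m) (+ n)) (sym (ℕP.*-identityˡ (2 ^ β)))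
                                                      (2^β-unit m 2∤m β)))
  residueCount≡3 a₁ s (suc zero) β _ 3∤gcd m 2∤m with 3 ∣? m
  ... | yes (ℕDiv.divides q m≡q*3) =
    triple-case a₁ s β m q (trans m≡q*3 (ℕP.*-comm q 3)) 2∤m (π₃≢0 a₁ s (2 ^ β) 3∤gcd)
  ... | no 3∤m = residueCount-unit m a₁ (neg-signed-unit s 3·2^β-unit)
    where
      3·2^β-unit : IsUnit (+ m) (+ (3 * 2 ^ β))
      3·2^β-unit = subst (IsUnit (+ m)) (sym (ℤP.pos-* 3 (2 ^ β))) (unit-* (OddModulus.three-unit m 3∤m) (2^β-unit m 2∤m β))
  residueCount≡3 _ _ (suc (suc _)) _ (s≤s ())

module Balance (m : ℕ) .{{_ : NonZero m}} (a₁ a₂ : ℤ) where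

  open import Data.Nat using (suc; _*_)
  import Data.Nat.Properties as ℕP
  open import Data.Nat.Tactic.RingSolver using (solve-∀)
  open import Data.Integer using (+_; -_; _+_) renaming (_*_ to _⊛_)
  open import Data.Integer.Tactic.RingSolver using () renaming (solve-∀ to ℤ-solve-∀)
  open import Data.Fin.Properties using (toℕ<n)
  open import Relation.Binary.PropositionalEquality
  open import Defs using (π; orbit; ∇; prefix; mult; Balanced)
  open Modular
  open Congruence (+ m)
  open Reduction m
  open FiniteSums
  open ResidueSums
  open ClosedForm using (ε)
  open OrbitOfS m a₁ a₂ using (S)
  open EntryCount m a₁ a₂
  open ResidueCounts m using (residueCount)
  open Multiplicities using (mult-∇)
  open TriangleSums using (∑△)
  open ≡-Reasoning

  ∑-Ψ : ∀ x → ∑[ g < m ] Ψ x (π m (- + g)) ≡ residueCount a₁ (- a₂) x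
  ∑-Ψ x = trans (∑-cong m (λ g _ → ∑₃-cong (λ ρ → cong 𝟙[ x ≡_] (π-cong (+-congˡ (a₁ ⊛ ε ρ) (reflect g))))))
                (∑-∑₃ m (λ g ρ → 𝟙[ x ≡ π m (a₁ ⊛ ε ρ + - a₂ ⊛ + g) ]))
    where
      reflect : ∀ g → a₂ ⊛ + π m (- + g) ≡ - a₂ ⊛ + g [mod + m ]
      reflect g = ≡-mod-trans (*-congˡ a₂ (π-≡-mod (- + g))) (≡⇒≡-mod (neg-swap a₂ (+ g)))
        where
          neg-swap : ∀ a g → a ⊛ - g ≡ - a ⊛ g
          neg-swap = ℤ-solve-∀

  module _ (w : ℕ) (3m≡1+2w : 3 * m ≡ suc (2 * w)) where

    private
      instance
        3m≢0 : NonZero (3 * m)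
        3m≢0 = ℕP.m*n≢0 3 m

    open TriangleDifferences (3 * m) w 3m≡1+2w using (differences)

    mult-∇-S : ∀ l x → mult x (∇ m (prefix S (3 * l * m))) ≡ differences (l * (3 * m)) 0 * residueCount a₁ (- a₂) x
    mult-∇-S l x = begin
      mult x (∇ m (prefix S (3 * l * m)))                          ≡⟨ cong (λ n → mult x (∇ m (prefix S n))) (reorder l m) ⟩
      mult x (∇ m (prefix S N))                                    ≡⟨ mult-∇ m S x N ⟩
      ∑△ N (λ i t → 𝟙[ x ≡ orbit m S i (+ t) ])                    ≡⟨ count-entries l w 3m≡1+2w x ⟩
      differences N 0 * ∑[ g < m ] Ψ x (π m (- + g))               ≡⟨ cong (differences N 0 *_) (∑-Ψ x) ⟩
      differences N 0 * residueCount a₁ (- a₂) x                   ∎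
      where
        N = l * (3 * m)
        reorder : ∀ l m → 3 * l * m ≡ l * (3 * m)
        reorder = solve-∀

    balanced : (∀ {x} → x ℕ.< m → residueCount a₁ (- a₂) x ≡ 3) → ∀ l → Balanced m (∇ m (prefix S (3 * l * m)))
    balanced count≡3 l c d = trans (multiplicity c) (sym (multiplicity d))
      where
        multiplicity : ∀ c → mult (toℕ c) (∇ m (prefix S (3 * l * m))) ≡ differences (l * (3 * m)) 0 * 3
        multiplicity c = trans (mult-∇-S l (toℕ c)) (cong (differences (l * (3 * m)) 0 *_) (count≡3 (toℕ<n c)))

open import Defs
open import Data.Nat using (ℕ; NonZero; _≤_; _*_; _^_)
open import Data.Nat.Divisibility using () renaming (_∣_ to _∣ℕ_)
open import Data.Integer using (ℤ; +_)
open import Data.Integer.Divisibility using (_∣_)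
open import Data.Integer.GCD using (gcd)
open import Data.Bool using (Bool)
open import Data.Product using (_×_; _,_; proj₁; proj₂)
open import Relation.Nullary using (¬_)

corollary8 : (a₁ : ℤ) (s : Bool) (α β : ℕ) → α ≤ 1 →
    ¬ (+ 3 ∣ gcd a₁ (signed s (+ (3 ^ α * 2 ^ β)))) →
    (m : ℕ) .{{_ : NonZero m}} → ¬ (2 ∣ℕ m) →
    let A = πT m (lincomb a₁ (signed s (+ (3 ^ α * 2 ^ β))))
        S = IAP m 24 A (rowMul m A X24)
    in PeriodicOrbit m S (3 * m) (3 * m)
       × (∀ (λ' : ℕ) → Balanced m (∇ m (prefix S (3 * λ' * m))))
corollary8 a₁ s α β α≤1 3∤gcd m 2∤m =
  OrbitOfS.orbit-periodic m a₁ a₂ ,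
  Balance.balanced m a₁ a₂ w 3m≡1+2w (CoefficientsInO.residueCount≡3 a₁ s α β α≤1 3∤gcd m 2∤m)
  where
    a₂ = signed s (+ (3 ^ α * 2 ^ β))
    w = proj₁ (OddModulus.3m-odd m 2∤m)
    3m≡1+2w = proj₂ (OddModulus.3m-odd m 2∤m)
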